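{- Let $Q$ be a type $A$ quiver with vertex set $\{1,\dots,n\}$ and $\mathbf{a}\in\mathbb{Z}^n$. Assume that $[\mathbf{a}]_+=([a_1]_+,\dots,[a_n]_+)$ belongs to $\mathcal{W}$. Assume further that $x[[\mathbf{a}]_+]=\prod_{\mathbf{b}}x[\mathbf{b}]$ is a factorization into cluster variables $x[\mathbf{b}]$ lying in one cluster. Then $$x[\mathbf{a}]=x[[\mathbf{a}]_+]\prod_i x_i^{[-a_i]_+}=\prod_{\mathbf{b}}x[\mathbf{b}]\prod_i x_i^{[-a_i]_+},$$ and the cluster variables $x[\mathbf{b}]$ together with the $x_i$ for $i$ with $a_i<0$ lie in a common cluster.
   Context: A quiver is a finite directed graph without loops or $2$-cycles. $\mathcal{A}(Q)\subset\mathbb{Q}(x_1,\dots,x_n)$ is the coefficient-free cluster algebra. Its cluster variables are obtained from $((x_1,\dots,x_n),Q)$ by iterated mutations. A cluster monomial is a product of nonnegative powers of cluster variables of one cluster. A type $A$ quiver (mutation-equivalent to $1\to\cdots\to n$) arises from a triangulation of a convex $(n+3)$-gon by non-crossing diagonals $T_1,\dots,T_n$: there is an arrow $i\to j$ iff $T_i,T_j$ are sides of a common triangle and $T_j$ is obtained from $T_i$ by counterclockwise rotation (less than $180^\circ$) about their common endpoint. Cluster variables correspond bijectively to diagonals ($x_i\leftrightarrow T_i$), and cluster monomials to collections $\{(D_j,d_j)\}$ of distinct pairwise non-crossing diagonals with positive multiplicities. For diagonals $D,E$ set $i(D,E)=1$ if they cross in the interior, $-1$ if equal, and $0$ otherwise.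 The $\mathbf{d}$-vector is $a_i=\sum_jd_j\,i(D_j,T_i)$. $\mathcal{W}$ is the set of $\mathbf{c}\in\mathbb{Z}^n$ such that $c_i+c_j+c_k$ is even for every $3$-cycle $i\to j\to k\to i$ of $Q$ with $c_i,c_j,c_k$ positive and satisfying the strict triangle inequalities. For $\mathbf{c}\in\mathcal{W}$ there is a unique cluster monomial with $\mathbf{d}$-vector $\mathbf{c}$, denoted $x[\mathbf{c}]$. $[x]_+=\max(x,0)$. -}

module Defs where

open import Data.Bool using (Bool; true; false; _∧_; _∨_; if_then_else_; T)
open import Data.Nat using (ℕ; zero; suc; _+_; _∸_; _<_; _≤_; _%_; _<ᵇ_; _≡ᵇ_)
open import Data.Integer as ℤ using (ℤ; +_; -[1+_])
open import Data.Integer.Divisibility using () renaming (_∣_ to _∣ℤ_)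
open import Data.Fin using (Fin)
open import Data.List using (List; []; _∷_; _++_; foldr; allFin)
open import Data.List.Relation.Unary.All using (All)
open import Data.List.Relation.Unary.AllPairs using (AllPairs)
open import Data.Product using (_×_; _,_; ∃; ∃-syntax; proj₁; proj₂)
open import Data.Sum using (_⊎_)
open import Relation.Binary.PropositionalEquality using (_≡_; _≢_)
open import Relation.Nullary using (¬_)

-- Convex N-gon with vertices 0,1,…,N-1 labelled counterclockwise.
-- A diagonal is an ordered pair (p , q) with p < q, not a side.

Diag : Set
Diag = ℕ × ℕ

IsDiagonal : ℕ → Diag → Set
IsDiagonal N (p , q) = (suc (suc p) ≤ q) × (q < N) × ¬ (p ≡ 0 × suc q ≡ N)

crossᵇ : Diag → Diag → Bool
crossᵇ (p , q) (r , s) =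
  ((p <ᵇ r) ∧ (r <ᵇ q) ∧ (q <ᵇ s)) ∨ ((r <ᵇ p) ∧ (p <ᵇ s) ∧ (s <ᵇ q))

Crosses : Diag → Diag → Set
Crosses D E = T (crossᵇ D E)

eqᵇ : Diag → Diag → Bool
eqᵇ (p , q) (r , s) = (p ≡ᵇ r) ∧ (q ≡ᵇ s)

inter : Diag → Diag → ℤ
inter D E = if eqᵇ D E then ℤ.-[1+ 0 ] else (if crossᵇ D E then + 1 else + 0)

Triangulation : ℕ → Set
Triangulation n = Fin n → Diag

IsTriangulation : (n : ℕ) → Triangulation n → Set
IsTriangulation n Tr =
  (∀ i → IsDiagonal (3 + n) (Tr i)) ×
  (∀ i j → Tr i ≡ Tr j → i ≡ j) ×
  (∀ i j → ¬ Crosses (Tr i) (Tr j))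

Ends : Diag → ℕ → ℕ → Set
Ends D v u = (D ≡ (v , u)) ⊎ (D ≡ (u , v))

Side : ℕ → ℕ → ℕ → Set
Side N u w = (suc u ≡ w) ⊎ (suc w ≡ u) ⊎ ((u ≡ 0) × (suc w ≡ N)) ⊎ ((w ≡ 0) × (suc u ≡ N))

InTr : {n : ℕ} → Triangulation n → ℕ → ℕ → Set
InTr Tr u w = ∃[ k ] Ends (Tr k) u w

-- The quiver Q(T): arrow i → j iff Tᵢ = {v,u}, Tⱼ = {v,w} are sides of a
-- common triangle {v,u,w} of the triangulation (i.e. {u,w} is a side of
-- the polygon or a diagonal of T) and Tⱼ is obtained from Tᵢ by
-- counterclockwise rotation about v, i.e. w comes after u when going
-- counterclockwise around the polygon starting from v.
Arrow : (n : ℕ) → Triangulation n → Fin n → Fin n → Set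
Arrow n Tr i j =
  ∃[ v ] ∃[ u ] ∃[ w ]
    Ends (Tr i) v u × Ends (Tr j) v w ×
    (Side (3 + n) u w ⊎ InTr Tr u w) ×
    ((u + (3 + n) ∸ v) % (3 + n) < (w + (3 + n) ∸ v) % (3 + n))

InW : (n : ℕ) → Triangulation n → (Fin n → ℤ) → Set
InW n Tr c =
  ∀ i j k → Arrow n Tr i j → Arrow n Tr j k → Arrow n Tr k i →
  + 0 ℤ.< c i → + 0 ℤ.< c j → + 0 ℤ.< c k →
  c i ℤ.< c j ℤ.+ c k → c j ℤ.< c i ℤ.+ c k → c k ℤ.< c i ℤ.+ c j →
  (+ 2) ∣ℤ (c i ℤ.+ c j ℤ.+ c k)

-- Cluster monomials: collections {(Dⱼ , dⱼ)} of distinct pairwise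
-- non-crossing diagonals with positive multiplicities.

Collection : Set
Collection = List (Diag × ℕ)

IsClusterMonomial : ℕ → Collection → Set
IsClusterMonomial N M =
  All (λ Dd → IsDiagonal N (proj₁ Dd) × (0 < proj₂ Dd)) M ×
  AllPairs (λ Dd Ee → (proj₁ Dd ≢ proj₁ Ee) × ¬ Crosses (proj₁ Dd) (proj₁ Ee)) M

dvec : {n : ℕ} → Triangulation n → Collection → Fin n → ℤ
dvec Tr M i = foldr (λ Dd acc → (+ proj₂ Dd) ℤ.* inter (proj₁ Dd) (Tr i) ℤ.+ acc) (+ 0) M

pos : ℤ → ℕ
pos (+ k) = k
pos -[1+ k ] = 0

neg : ℤ → ℕ
neg (+ k) = 0
neg -[1+ k ] = suc k

posPart : {n : ℕ} → (Fin n → ℤ) → Fin n → ℤ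
posPart a i = + pos (a i)

-- the factor ∏ᵢ xᵢ^{[-aᵢ]₊}, as the collection {(Tᵢ , -aᵢ) : aᵢ < 0}
negEntry : Diag → ℤ → Collection
negEntry D (+ _) = []
negEntry D -[1+ k ] = (D , suc k) ∷ []

negPart : {n : ℕ} → Triangulation n → (Fin n → ℤ) → Collection
negPart {n} Tr a = foldr (λ i acc → negEntry (Tr i) (a i) ++ acc) [] (allFin n)

-- The d-vector of a cluster monomial L records the intersection numbers
-- i(L, Tᵢ) = #crossings − multiplicity.  As a compatible collection never both contains
-- and crosses a diagonal X, i(L, X) determines both numbers.  They propagate from the Tᵢ
-- to every chord X by induction on the number of Tᵢ crossing X: such a Tᵢ and X are the
-- diagonals of a quadrilateral whose sides are crossed by fewer Tᵢ, and counting how the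
-- chords of L cut the corners of the quadrilateral and of its four triangles expresses
-- i(L, X) through quantities already known.  So the d-vector determines the cluster
-- monomial up to order.  For existence, M neither contains nor crosses any Tᵢ with
-- aᵢ < 0, since i(M, Tᵢ) = [aᵢ]₊ = 0, so adjoining these Tᵢ keeps the collection compatible.
module Submission where

open import Defs
open import Data.Bool using (Bool; true; false; _∧_; _∨_; not; T)
open import Data.Bool.Properties using (∨-comm; T-∧; T-∨; T-≡)
open import Data.Empty using (⊥; ⊥-elim)
open import Data.Fin as Fin using (Fin; zero; suc)
import Data.Fin.Properties as Fin
open import Data.Fin.Patterns using (0F; 1F; 2F; 3F)
open import Data.Integer as ℤ using (ℤ; _⊖_)
import Data.Integer.Properties as ℤ
open import Data.List using (List; []; _∷_; _++_; map; foldr; allFin)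
open import Data.List.Properties using (map-∘)
open import Data.List.Relation.Binary.Permutation.Propositional using (_↭_)
open import Data.List.Relation.Unary.All as All using (All; []; _∷_)
import Data.List.Relation.Unary.All.Properties as AllP
open import Data.List.Relation.Unary.AllPairs as AllPairs using (AllPairs; []; _∷_)
import Data.List.Relation.Unary.AllPairs.Properties as AllPairsP
open import Data.List.Relation.Unary.Any using (Any; here; there)
import Data.List.Relation.Unary.Any.Properties as AnyP
open import Data.Nat using (ℕ; zero; suc; pred; >-nonZero; _+_; _*_; _∸_; _⊓_; _<_; _≤_; _<ᵇ_; _≡ᵇ_; z≤n; s≤s)
open import Data.Nat.ListAction using (sum)
open import Data.Nat.Properties
open import Algebra.Properties.CommutativeSemigroup +-commutativeSemigroup using (interchange; x∙yz≈y∙xz)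
open import Data.Product using (_×_; _,_; proj₁; proj₂; ∃-syntax)
open import Data.Product.Properties using (≡-dec)
open import Data.Sum using (_⊎_; inj₁; inj₂; [_,_]′; swap)
open import Data.Vec using (Vec; []; _∷_; lookup; tabulate)
open import Data.Vec.Properties using (tabulate-cong)
open import Data.Vec.Relation.Unary.All using ([]; _∷_)
import Data.Vec.Relation.Unary.All.Properties as VecAllP
open import Data.Vec.Relation.Unary.AllPairs using ([]; _∷_) renaming (AllPairs to AllPairsᵛ)
open import Function using (_∘_; _$_; id)
open import Function.Bundles using (Equivalence)
open import Relation.Binary using (tri<; tri≈; tri>)
open import Relation.Binary.PropositionalEquality
open import Relation.Nullary using (¬_; Dec; yes; no)
open import Relation.Nullary.Decidable using (True; toWitness; T?; ¬?; map′; _→-dec_; _×-dec_)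

⟦_⟧ : Bool → ℕ
⟦ true ⟧ = 1
⟦ false ⟧ = 0

T-ext : ∀ {a b} → (T a → T b) → (T b → T a) → a ≡ b
T-ext {false} {false} _ _ = refl
T-ext {false} {true} _ b⇒a = ⊥-elim (b⇒a _)
T-ext {true} {false} a⇒b _ = ⊥-elim (a⇒b _)
T-ext {true} {true} _ _ = refl

¬T⇒≡false : ∀ {b} → ¬ T b → b ≡ false
¬T⇒≡false {false} _ = refl
¬T⇒≡false {true} ¬b = ⊥-elim (¬b _)

T-not∧ : ∀ {a b} → ¬ T a → T b → T (not a ∧ b)
T-not∧ {false} {true} _ _ = _
T-not∧ {true} ¬a _ = ⊥-elim (¬a _)

⟦⟧-mono : ∀ {a b} → (T a → T b) → ⟦ a ⟧ ≤ ⟦ b ⟧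
⟦⟧-mono {false} _ = z≤n
⟦⟧-mono {true} {true} _ = ≤-refl
⟦⟧-mono {true} {false} a⇒b = ⊥-elim (a⇒b _)

<ᵇ-ext : ∀ {x y u v} → (x < y → u < v) → (u < v → x < y) → (x <ᵇ y) ≡ (u <ᵇ v)
<ᵇ-ext {x} {y} {u} {v} f g = T-ext (<⇒<ᵇ ∘ f ∘ <ᵇ⇒< x y) (<⇒<ᵇ ∘ g ∘ <ᵇ⇒< u v)

≡ᵇ-ext : ∀ {x y u v} → (x ≡ y → u ≡ v) → (u ≡ v → x ≡ y) → (x ≡ᵇ y) ≡ (u ≡ᵇ v)
≡ᵇ-ext {x} {y} {u} {v} f g = T-ext (≡⇒≡ᵇ u v ∘ f ∘ ≡ᵇ⇒≡ x y) (≡⇒≡ᵇ x y ∘ g ∘ ≡ᵇ⇒≡ u v)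

eqᵇ⇒≡ : ∀ E F → T (eqᵇ E F) → E ≡ F
eqᵇ⇒≡ (p , q) (r , s) h =
  let p≡r , q≡s = Equivalence.to T-∧ h in cong₂ _,_ (≡ᵇ⇒≡ p r p≡r) (≡ᵇ⇒≡ q s q≡s)

eqᵇ-refl : ∀ E → T (eqᵇ E E)
eqᵇ-refl (p , q) = Equivalence.from T-∧ (≡⇒≡ᵇ p p refl , ≡⇒≡ᵇ q q refl)

<ᵇ-chain : ∀ x y z w → T ((x <ᵇ y) ∧ (y <ᵇ z) ∧ (z <ᵇ w)) → x < y × y < z × z < w
<ᵇ-chain x y z w h =
  let x<y , y<z<w = Equivalence.to T-∧ h ; y<z , z<w = Equivalence.to T-∧ y<z<w
  in <ᵇ⇒< x y x<y , <ᵇ⇒< y z y<z , <ᵇ⇒< z w z<w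

Crosses-view : ∀ {p q r s} → Crosses (p , q) (r , s) → (p < r × r < q × q < s) ⊎ (r < p × p < s × s < q)
Crosses-view {p} {q} {r} {s} c with Equivalence.to T-∨ c
... | inj₁ h = inj₁ (<ᵇ-chain p r q s h)
... | inj₂ h = inj₂ (<ᵇ-chain r p s q h)

Crosses-intro : ∀ {p q r s} → p < r → r < q → q < s → Crosses (p , q) (r , s)
Crosses-intro p<r r<q q<s = Equivalence.from T-∨ (inj₁
  (Equivalence.from T-∧ (<⇒<ᵇ p<r , Equivalence.from T-∧ (<⇒<ᵇ r<q , <⇒<ᵇ q<s))))

Crosses-sym : ∀ {E F} → Crosses E F → Crosses F E
Crosses-sym {p , q} {r , s} = subst T (∨-comm ((p <ᵇ r) ∧ (r <ᵇ q) ∧ (q <ᵇ s)) _)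

Crosses-irrefl : ∀ E → ¬ Crosses E E
Crosses-irrefl (p , q) c with Crosses-view {p} {q} {p} {q} c
... | inj₁ (p<p , _) = <-irrefl refl p<p
... | inj₂ (p<p , _) = <-irrefl refl p<p

shared-end-uncrossed : ∀ p q r s → p ≡ r ⊎ p ≡ s ⊎ q ≡ r ⊎ q ≡ s → ¬ Crosses (p , q) (r , s)
shared-end-uncrossed p q r s shared c with Crosses-view {p} {q} {r} {s} c | shared
... | inj₁ (p<r , _ , _) | inj₁ refl = <-irrefl refl p<r
... | inj₁ (p<r , r<q , q<s) | inj₂ (inj₁ refl) = <-irrefl refl (<-trans p<r (<-trans r<q q<s))
... | inj₁ (_ , r<q , _) | inj₂ (inj₂ (inj₁ refl)) = <-irrefl refl r<q
... | inj₁ (_ , _ , q<s) | inj₂ (inj₂ (inj₂ refl)) = <-irrefl refl q<s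
... | inj₂ (r<p , _ , _) | inj₁ refl = <-irrefl refl r<p
... | inj₂ (_ , p<s , _) | inj₂ (inj₁ refl) = <-irrefl refl p<s
... | inj₂ (r<p , p<s , s<q) | inj₂ (inj₂ (inj₁ refl)) = <-irrefl refl (<-trans r<p (<-trans p<s s<q))
... | inj₂ (_ , _ , s<q) | inj₂ (inj₂ (inj₂ refl)) = <-irrefl refl s<q

edge-uncrossed : ∀ E q → ¬ Crosses E (q , suc q)
edge-uncrossed (e₁ , e₂) q c with Crosses-view {e₁} {e₂} {q} {suc q} c
... | inj₁ (_ , q<e₂ , e₂<q+1) = <⇒≱ q<e₂ (≤-pred e₂<q+1)
... | inj₂ (q<e₁ , e₁<q+1 , _) = <⇒≱ q<e₁ (≤-pred e₁<q+1)

outer-edge-uncrossed : ∀ {M} r s → s ≤ M → ¬ Crosses (0 , M) (r , s)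
outer-edge-uncrossed {M} r s s≤M c with Crosses-view {0} {M} {r} {s} c
... | inj₁ (_ , _ , M<s) = <⇒≱ M<s s≤M
... | inj₂ (r<0 , _) = <⇒≱ r<0 z≤n

diagonal-or-edge : ∀ {N q s} → q < s → s < N → IsDiagonal N (q , s) ⊎ s ≡ suc q ⊎ (q ≡ 0 × suc s ≡ N)
diagonal-or-edge {N} {q} {s} q<s s<N with suc (suc q) ≤? s | q ≟ 0 | suc s ≟ N
... | no narrow | _ | _ = inj₂ (inj₁ (≤-antisym (≤-pred (≰⇒> narrow)) q<s))
... | yes _ | yes q≡0 | yes s+1≡N = inj₂ (inj₂ (q≡0 , s+1≡N))
... | yes wide | no q≢0 | _ = inj₁ (wide , s<N , q≢0 ∘ proj₁)
... | yes wide | _ | no s+1≢N = inj₁ (wide , s<N , s+1≢N ∘ proj₂)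

isDiagonal? : ∀ N X → Dec (IsDiagonal N X)
isDiagonal? N (p , q) = (suc (suc p) ≤? q) ×-dec ((q <? N) ×-dec ¬? ((p ≟ 0) ×-dec (suc q ≟ N)))

count : Collection → (Diag → Bool) → ℕ
count [] φ = 0
count ((E , k) ∷ L) φ = ⟦ φ E ⟧ * k + count L φ

crossings mult : Collection → Diag → ℕ
crossings L X = count L λ E → crossᵇ E X
mult L X = count L λ E → eqᵇ E X

Compatible : Collection → Set
Compatible = AllPairs λ D E → ¬ Crosses (proj₁ D) (proj₁ E)

Positive : Collection → Set
Positive = All λ D → 0 < proj₂ D

count-none : ∀ {φ} L → All (λ D → ¬ T (φ (proj₁ D))) L → count L φ ≡ 0
count-none [] [] = refl
count-none {φ} ((E , k) ∷ L) (¬φE ∷ ¬φL) with φ E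
... | true = ⊥-elim (¬φE _)
... | false = count-none L ¬φL

count≡0⇒none : ∀ {φ} L → Positive L → count L φ ≡ 0 → All (λ D → ¬ T (φ (proj₁ D))) L
count≡0⇒none [] [] _ = []
count≡0⇒none {φ} ((E , k) ∷ L) (k>0 ∷ positive) count≡0 with φ E in φE
... | true = (λ _ → <⇒≢ k>0 (sym k≡0)) ∷ count≡0⇒none L positive (m+n≡0⇒n≡0 (k + 0) count≡0)
  where
  k≡0 : k ≡ 0
  k≡0 = trans (sym (+-identityʳ k)) (m+n≡0⇒m≡0 (k + 0) count≡0)
... | false = subst T φE ∷ count≡0⇒none L positive count≡0

count>0⇒any : ∀ {φ} L → 0 < count L φ → Any (λ D → T (φ (proj₁ D))) L
count>0⇒any {φ} ((E , k) ∷ L) count>0 with φ E in φE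
... | true = here (subst T (sym φE) _)
... | false = there (count>0⇒any L count>0)

count-exclusive : ∀ {φ ψ} → (∀ {E F} → T (φ E) → T (ψ F) → Crosses E F) →
  ∀ {L} → Compatible L → count L φ ≡ 0 ⊎ count L ψ ≡ 0
count-exclusive clash [] = inj₁ refl
count-exclusive {φ} {ψ} clash {(E , k) ∷ L} (uncrossed ∷ compatible) with φ E in φE | ψ E in ψE
... | true | true = ⊥-elim (Crosses-irrefl E (clash (subst T (sym φE) _) (subst T (sym ψE) _)))
... | true | false = inj₂ (count-none L (All.map (λ ¬EF ψF → ¬EF (clash (subst T (sym φE) _) ψF)) uncrossed))
... | false | true = inj₁ (count-none L (All.map
  (λ {(F , _)} ¬EF φF → ¬EF (Crosses-sym {F} {E} (clash φF (subst T (sym ψE) _)))) uncrossed))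
... | false | false = count-exclusive clash compatible

count-mono : ∀ {φ ψ} L → All (λ D → T (φ (proj₁ D)) → T (ψ (proj₁ D))) L → count L φ ≤ count L ψ
count-mono [] [] = z≤n
count-mono ((E , k) ∷ L) (φ⇒ψ ∷ implied) = +-mono-≤ (*-monoˡ-≤ k (⟦⟧-mono φ⇒ψ)) (count-mono L implied)

count-< : ∀ {φ ψ} L → All (λ D → T (φ (proj₁ D)) → T (ψ (proj₁ D))) L →
  Any (λ D → 0 < proj₂ D × ¬ T (φ (proj₁ D)) × T (ψ (proj₁ D))) L → count L φ < count L ψ
count-< {φ} {ψ} ((E , k) ∷ L) (_ ∷ implied) (here (k>0 , ¬φE , ψE)) with φ E | ψ E
... | true | _ = ⊥-elim (¬φE _)
... | false | true = +-mono-<-≤ (<-≤-trans k>0 (≤-reflexive (sym (+-identityʳ k)))) (count-mono L implied)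
count-< ((E , k) ∷ L) (φ⇒ψ ∷ implied) (there witness) =
  +-mono-≤-< (*-monoˡ-≤ k (⟦⟧-mono φ⇒ψ)) (count-< L implied witness)

count-++ : ∀ {φ} L L' → count (L ++ L') φ ≡ count L φ + count L' φ
count-++ [] L' = refl
count-++ {φ} ((E , k) ∷ L) L' = trans (cong (⟦ φ E ⟧ * k +_) (count-++ L L')) (sym (+-assoc (⟦ φ E ⟧ * k) _ _))

indicators : ∀ {A : Set} → List (A → Bool) → A → ℕ
indicators φs x = sum (map (λ φ → ⟦ φ x ⟧) φs)

counts : Collection → List (Diag → Bool) → ℕ
counts L φs = sum (map (count L) φs)

counts-[] : ∀ φs → counts [] φs ≡ 0
counts-[] [] = refl
counts-[] (φ ∷ φs) = counts-[] φs

counts-∷ : ∀ E k L φs → counts ((E , k) ∷ L) φs ≡ indicators φs E * k + counts L φs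
counts-∷ E k L [] = refl
counts-∷ E k L (φ ∷ φs) = begin
  ⟦ φ E ⟧ * k + count L φ + counts ((E , k) ∷ L) φs
    ≡⟨ cong (⟦ φ E ⟧ * k + count L φ +_) (counts-∷ E k L φs) ⟩
  ⟦ φ E ⟧ * k + count L φ + (indicators φs E * k + counts L φs)
    ≡⟨ interchange (⟦ φ E ⟧ * k) (count L φ) _ _ ⟩
  ⟦ φ E ⟧ * k + indicators φs E * k + (count L φ + counts L φs)
    ≡⟨ cong (_+ (count L φ + counts L φs)) (*-distribʳ-+ k ⟦ φ E ⟧ _) ⟨
  indicators (φ ∷ φs) E * k + counts L (φ ∷ φs)
    ∎
  where open ≡-Reasoning

count-linear : ∀ φs ψs → (∀ E → indicators φs E ≡ indicators ψs E) → ∀ L → counts L φs ≡ counts L ψs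
count-linear φs ψs _ [] = trans (counts-[] φs) (sym (counts-[] ψs))
count-linear φs ψs same ((E , k) ∷ L) = begin
  counts ((E , k) ∷ L) φs           ≡⟨ counts-∷ E k L φs ⟩
  indicators φs E * k + counts L φs ≡⟨ cong₂ (λ i c → i * k + c) (same E) (count-linear φs ψs same L) ⟩
  indicators ψs E * k + counts L ψs ≡⟨ counts-∷ E k L ψs ⟨
  counts ((E , k) ∷ L) ψs           ∎
  where open ≡-Reasoning

-- The constructor +_ is opened only here: at top level it makes sections like (x +_) ambiguous.
module _ where
  open import Data.Integer using (+_)

  -- dvec Tr L i unfolds to intersection L (Tr i).
  intersection : Collection → Diag → ℤ
  intersection L X = foldr (λ Dd acc → (+ proj₂ Dd) ℤ.* inter (proj₁ Dd) X ℤ.+ acc) (+ 0) L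

  inter≡ : ∀ E X → inter E X ≡ + ⟦ crossᵇ E X ⟧ ℤ.- + ⟦ eqᵇ E X ⟧
  inter≡ E X with eqᵇ E X in E≡X | crossᵇ E X in E×X
  ... | true | true = ⊥-elim (Crosses-irrefl X
          (subst (λ D → Crosses D X) (eqᵇ⇒≡ E X (subst T (sym E≡X) _)) (subst T (sym E×X) _)))
  ... | true | false = refl
  ... | false | true = refl
  ... | false | false = refl

  intersection≡ : ∀ L X → intersection L X ≡ + crossings L X ℤ.- + mult L X
  intersection≡ [] X = refl
  intersection≡ ((E , k) ∷ L) X = begin
    + k ℤ.* inter E X ℤ.+ intersection L X
      ≡⟨ cong₂ (λ i j → + k ℤ.* i ℤ.+ j) (inter≡ E X) (intersection≡ L X) ⟩
    + k ℤ.* (+ x ℤ.- + y) ℤ.+ (+ c ℤ.- + m)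
      ≡⟨ distribute (+ k) (+ x) (+ y) (+ c) (+ m) ⟩
    (+ x ℤ.* + k ℤ.+ + c) ℤ.- (+ y ℤ.* + k ℤ.+ + m)
      ≡⟨ cong₂ ℤ._-_ (cast x c) (cast y m) ⟨
    + (x * k + c) ℤ.- + (y * k + m)
      ∎
    where
    open ≡-Reasoning
    open import Data.Integer.Tactic.RingSolver using (solve-∀)
    x = ⟦ crossᵇ E X ⟧
    y = ⟦ eqᵇ E X ⟧
    c = crossings L X
    m = mult L X
    distribute : ∀ k x y c m → k ℤ.* (x ℤ.- y) ℤ.+ (c ℤ.- m) ≡ (x ℤ.* k ℤ.+ c) ℤ.- (y ℤ.* k ℤ.+ m)
    distribute = solve-∀
    cast : ∀ a b → + (a * k + b) ≡ + a ℤ.* + k ℤ.+ + b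
    cast a b = trans (ℤ.pos-+ (a * k) b) (cong (ℤ._+ + b) (ℤ.pos-* a k))

  intersection≡⊖ : ∀ L X → intersection L X ≡ crossings L X ⊖ mult L X
  intersection≡⊖ L X = trans (intersection≡ L X) (ℤ.[+m]-[+n]≡m⊖n (crossings L X) (mult L X))

  intersection-++ : ∀ L L' X → intersection (L ++ L') X ≡ intersection L X ℤ.+ intersection L' X
  intersection-++ [] L' X = sym (ℤ.+-identityˡ _)
  intersection-++ ((E , k) ∷ L) L' X = trans (cong (λ i → + k ℤ.* inter E X ℤ.+ i) (intersection-++ L L' X))
                                             (sym (ℤ.+-assoc (+ k ℤ.* inter E X) _ _))

  ⊖-parts : ∀ {c m} → m ≡ 0 ⊎ c ≡ 0 → pos (c ⊖ m) ≡ c × neg (c ⊖ m) ≡ m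
  ⊖-parts {c} (inj₁ refl) rewrite ℤ.⊖-≥ {c} {0} z≤n = refl , refl
  ⊖-parts {m = zero} (inj₂ refl) = refl , refl
  ⊖-parts {m = suc m} (inj₂ refl) = refl , refl

  mult-or-crossings : ∀ {L} → Compatible L → ∀ X → mult L X ≡ 0 ⊎ crossings L X ≡ 0
  mult-or-crossings compatible X = count-exclusive clash compatible
    where
    clash : ∀ {E F} → T (eqᵇ E X) → T (crossᵇ F X) → Crosses E F
    clash {E} {F} E≡X F×X rewrite eqᵇ⇒≡ E X E≡X = Crosses-sym {F} {X} F×X

  decomposition : ∀ {L} → Compatible L → ∀ X →
    crossings L X ≡ pos (intersection L X) × mult L X ≡ neg (intersection L X)
  decomposition {L} compatible X rewrite intersection≡⊖ L X =
    let pos≡ , neg≡ = ⊖-parts (mult-or-crossings compatible X) in sym pos≡ , sym neg≡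

  vanishing-intersection : ∀ {L X} → Compatible L → Positive L → intersection L X ≡ + 0 →
    All (λ D → proj₁ D ≢ X × ¬ Crosses (proj₁ D) X) L
  vanishing-intersection {L} {X} compatible positive vanishes =
    All.zipWith (λ (¬eq , ¬cross) → ¬eq ∘ (λ D≡X → subst (λ D → T (eqᵇ D X)) (sym D≡X) (eqᵇ-refl X)) , ¬cross)
      (count≡0⇒none L positive mult≡0 , count≡0⇒none L positive crossings≡0)
    where
    crossings≡0 : crossings L X ≡ 0
    crossings≡0 = trans (proj₁ (decomposition compatible X)) (cong pos vanishes)
    mult≡0 : mult L X ≡ 0
    mult≡0 = trans (proj₂ (decomposition compatible X)) (cong neg vanishes)

⊖-transpose : ∀ p q p' q' → p + q ≡ p' + q' → p ⊖ p' ≡ q' ⊖ q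
⊖-transpose p q p' q' eq = begin
  p ⊖ p'               ≡⟨ ℤ.+-cancelˡ-⊖ q p p' ⟨
  (q + p) ⊖ (q + p')   ≡⟨ cong₂ _⊖_ (trans (+-comm q p) eq) (+-comm q p') ⟩
  (p' + q') ⊖ (p' + q) ≡⟨ ℤ.+-cancelˡ-⊖ p' q' q ⟩
  q' ⊖ q               ∎
  where open ≡-Reasoning

module Agreement {L₁ L₂ : Collection} (compatible₁ : Compatible L₁) (compatible₂ : Compatible L₂) where

  Agree : Diag → Set
  Agree X = intersection L₁ X ≡ intersection L₂ X

  crossings-agree : ∀ {X} → Agree X → crossings L₁ X ≡ crossings L₂ X
  crossings-agree {X} agree = begin
    crossings L₁ X          ≡⟨ proj₁ (decomposition compatible₁ X) ⟩
    pos (intersection L₁ X) ≡⟨ cong pos agree ⟩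
    pos (intersection L₂ X) ≡⟨ proj₁ (decomposition compatible₂ X) ⟨
    crossings L₂ X          ∎
    where open ≡-Reasoning

  mult-agree : ∀ {X} → Agree X → mult L₁ X ≡ mult L₂ X
  mult-agree {X} agree = begin
    mult L₁ X               ≡⟨ proj₂ (decomposition compatible₁ X) ⟩
    neg (intersection L₁ X) ≡⟨ cong neg agree ⟩
    neg (intersection L₂ X) ≡⟨ proj₂ (decomposition compatible₂ X) ⟨
    mult L₂ X               ∎
    where open ≡-Reasoning

-- Chords relative to finitely many points

-- Relative to sorted points p₀ < ⋯ < p_{k-1}, zone sends pᵢ to 2i+1 and every other
-- number to the even code of the gap it lies in.  Crossing and equality of a chord with
-- the chords (pᵢ, pⱼ) only depend on the zones of its endpoints, so a fact about one or
-- two chords relative to k points can be decided on the 2k+1 zone values.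

Sorted : ∀ {k} → Vec ℕ k → Set
Sorted = AllPairsᵛ _<_

zone : ∀ {k} → Vec ℕ k → ℕ → ℕ
zone [] x = 0
zone (p ∷ ps) x with <-cmp x p
... | tri< _ _ _ = 0
... | tri≈ _ _ _ = 1
... | tri> _ _ _ = 2 + zone ps x

zone-count : ℕ → ℕ
zone-count zero = 1
zone-count (suc k) = 2 + zone-count k

odd : ∀ {k} → Fin k → ℕ
odd zero = 1
odd (suc i) = 2 + odd i

zone-below : ∀ {k x} p (ps : Vec ℕ k) → x < p → zone (p ∷ ps) x ≡ 0
zone-below {x = x} p ps x<p with <-cmp x p
... | tri< _ _ _ = refl
... | tri≈ x≮p _ _ = ⊥-elim (x≮p x<p)
... | tri> x≮p _ _ = ⊥-elim (x≮p x<p)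

zone-at : ∀ {k} p (ps : Vec ℕ k) → zone (p ∷ ps) p ≡ 1
zone-at p ps with <-cmp p p
... | tri< _ p≢p _ = ⊥-elim (p≢p refl)
... | tri≈ _ _ _ = refl
... | tri> _ p≢p _ = ⊥-elim (p≢p refl)

zone-above : ∀ {k x} p (ps : Vec ℕ k) → p < x → zone (p ∷ ps) x ≡ 2 + zone ps x
zone-above {x = x} p ps p<x with <-cmp x p
... | tri< _ _ x≯p = ⊥-elim (x≯p p<x)
... | tri≈ _ _ x≯p = ⊥-elim (x≯p p<x)
... | tri> _ _ _ = refl

zone-bound : ∀ {k} (ps : Vec ℕ k) x → zone ps x < zone-count k
zone-bound [] x = s≤s z≤n
zone-bound (p ∷ ps) x with <-cmp x p
... | tri< _ _ _ = s≤s z≤n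
... | tri≈ _ _ _ = s≤s (s≤s z≤n)
... | tri> _ _ _ = s≤s (s≤s (zone-bound ps x))

zone-mono : ∀ {k} (ps : Vec ℕ k) {x y} → x ≤ y → zone ps x ≤ zone ps y
zone-mono [] _ = z≤n
zone-mono (p ∷ ps) {x} {y} x≤y with <-cmp x p | <-cmp y p
... | tri< _ _ _ | _ = z≤n
... | tri≈ _ refl _ | tri< y<p _ _ = ⊥-elim (<⇒≱ y<p x≤y)
... | tri≈ _ _ _ | tri≈ _ _ _ = ≤-refl
... | tri≈ _ _ _ | tri> _ _ _ = s≤s z≤n
... | tri> _ _ p<x | tri< y<p _ _ = ⊥-elim (<⇒≱ (<-trans y<p p<x) x≤y)
... | tri> _ _ p<x | tri≈ _ refl _ = ⊥-elim (<⇒≱ p<x x≤y)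
... | tri> _ _ _ | tri> _ _ _ = s≤s (s≤s (zone-mono ps x≤y))

zone-reflects-< : ∀ {k} (ps : Vec ℕ k) {x y} → zone ps x < zone ps y → x < y
zone-reflects-< ps z< = ≰⇒> λ y≤x → <⇒≱ z< (zone-mono ps y≤x)

zone² : ∀ {k} → Vec ℕ k → Diag → Diag
zone² ps (x , y) = zone ps x , zone ps y

Crosses-zone : ∀ {k} (ps : Vec ℕ k) E F → Crosses (zone² ps E) (zone² ps F) → Crosses E F
Crosses-zone ps (p , q) (r , s) c with Crosses-view c
... | inj₁ (p<r , r<q , q<s) = Crosses-intro (reflect p<r) (reflect r<q) (reflect q<s)
  where reflect = zone-reflects-< ps
... | inj₂ (r<p , p<s , s<q) = Crosses-sym {r , s} {p , q} (Crosses-intro (reflect r<p) (reflect p<s) (reflect s<q))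
  where reflect = zone-reflects-< ps

zone-point : ∀ {k} {ps : Vec ℕ k} → Sorted ps → ∀ i → zone ps (lookup ps i) ≡ odd i
zone-point {ps = p ∷ ps} _ zero = zone-at p ps
zone-point {ps = p ∷ ps} (p< ∷ sorted) (suc i) =
  trans (zone-above p ps (VecAllP.lookup⁺ p< i)) (cong (λ z → 2 + z) (zone-point sorted i))

zone-below-point : ∀ {k} {ps : Vec ℕ k} → Sorted ps → ∀ i {x} → x < lookup ps i → zone ps x < odd i
zone-below-point {ps = p ∷ ps} _ zero x<p = subst (_< 1) (sym (zone-below p ps x<p)) (s≤s z≤n)
zone-below-point {ps = p ∷ ps} (_ ∷ sorted) (suc i) {x} x< with <-cmp x p
... | tri< _ _ _ = s≤s z≤n
... | tri≈ _ _ _ = s≤s (s≤s z≤n)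
... | tri> _ _ _ = s≤s (s≤s (zone-below-point sorted i x<))

zone-above-point : ∀ {k} {ps : Vec ℕ k} → Sorted ps → ∀ i {x} → lookup ps i < x → odd i < zone ps x
zone-above-point {ps = p ∷ ps} _ zero p<x = subst (1 <_) (sym (zone-above p ps p<x)) (s≤s (s≤s z≤n))
zone-above-point {ps = p ∷ ps} (p< ∷ sorted) (suc i) {x} <x =
  subst (2 + odd i <_) (sym (zone-above p ps (<-trans (VecAllP.lookup⁺ p< i) <x)))
    (s≤s (s≤s (zone-above-point sorted i <x)))

chord-relation : Diag → ℕ → ℕ → Bool × Bool
chord-relation E P Q = crossᵇ E (P , Q) , eqᵇ E (P , Q)

chord-relation-zone : ∀ {k} {ps : Vec ℕ k} → Sorted ps → ∀ E i j →
  chord-relation E (lookup ps i) (lookup ps j) ≡ chord-relation (zone² ps E) (odd i) (odd j)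
chord-relation-zone {ps = ps} sorted (x , y) i j =
  cong₂ _,_ (cong₂ _∨_ (cong₂ _∧_ (below i x) (cong₂ _∧_ (above i y) (below j y)))
                       (cong₂ _∧_ (above i x) (cong₂ _∧_ (below j x) (above j y))))
            (cong₂ _∧_ (equal i x) (equal j y))
  where
  below : ∀ i x → (x <ᵇ lookup ps i) ≡ (zone ps x <ᵇ odd i)
  below i x = <ᵇ-ext (zone-below-point sorted i)
    (zone-reflects-< ps ∘ subst (zone ps x <_) (sym (zone-point sorted i)))

  above : ∀ i x → (lookup ps i <ᵇ x) ≡ (odd i <ᵇ zone ps x)
  above i x = <ᵇ-ext (zone-above-point sorted i)
    (zone-reflects-< ps ∘ subst (_< zone ps x) (sym (zone-point sorted i)))

  equal : ∀ i x → (x ≡ᵇ lookup ps i) ≡ (zone ps x ≡ᵇ odd i)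
  equal i x = ≡ᵇ-ext (λ { refl → zone-point sorted i }) reflect
    where
    reflect : zone ps x ≡ odd i → x ≡ lookup ps i
    reflect z≡ with <-cmp x (lookup ps i)
    ... | tri< x< _ _ = ⊥-elim (<-irrefl z≡ (zone-below-point sorted i x<))
    ... | tri≈ _ x≡ _ = x≡
    ... | tri> _ _ <x = ⊥-elim (<-irrefl (sym z≡) (zone-above-point sorted i <x))

Profile : ℕ → Set
Profile k = Vec (Vec (Bool × Bool) k) k

profile : ∀ {k} → (Fin k → ℕ) → Diag → Profile k
profile point E = tabulate λ i → tabulate λ j → chord-relation E (point i) (point j)

profile-zone : ∀ {k} {ps : Vec ℕ k} → Sorted ps → ∀ E → profile (lookup ps) E ≡ profile odd (zone² ps E)
profile-zone sorted E = tabulate-cong λ i → tabulate-cong λ j → chord-relation-zone sorted E i j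

at : ∀ {k} → Vec ℕ k → (Profile k → Bool) → Diag → Bool
at ps φ = φ ∘ profile (lookup ps)

crosses is : ∀ {k} → Fin k → Fin k → Profile k → Bool
crosses i j π = proj₁ (lookup (lookup π i) j)
is i j π = proj₂ (lookup (lookup π i) j)

infixr 6 _∧̇_
infixr 5 _∨̇_

_∧̇_ _∨̇_ : ∀ {k} → (Profile k → Bool) → (Profile k → Bool) → Profile k → Bool
(φ ∧̇ ψ) π = φ π ∧ ψ π
(φ ∨̇ ψ) π = φ π ∨ ψ π

¬̇_ : ∀ {k} → (Profile k → Bool) → Profile k → Bool
(¬̇ φ) π = not (φ π)

record Valid (k : ℕ) (φ : Profile k → Bool) : Set where
  constructor valid
  field holds : ∀ {x} → x < zone-count k → ∀ {y} → y < zone-count k → T (φ (profile odd (x , y)))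

valid? : ∀ k φ → Dec (Valid k φ)
valid? k φ = map′ valid Valid.holds
  (allUpTo? (λ x → allUpTo? (λ y → T? (φ (profile odd (x , y)))) (zone-count k)) (zone-count k))

valid-by-evaluation : ∀ {k φ} {evaluates : True (valid? k φ)} → Valid k φ
valid-by-evaluation {k} {φ} {evaluates} = toWitness {a? = valid? k φ} evaluates

valid⇒true : ∀ {k} {ps : Vec ℕ k} {φ} → Sorted ps → Valid k φ → ∀ E → T (at ps φ E)
valid⇒true {ps = ps} {φ} sorted (valid holds) (x , y) =
  subst (T ∘ φ) (sym (profile-zone sorted (x , y))) (holds (zone-bound ps x) (zone-bound ps y))

record Implies (k : ℕ) (φ ψ : Profile k → Bool) : Set where
  constructor implies
  field pointwise : Valid k λ π → not (φ π) ∨ ψ π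

implies-by-evaluation : ∀ {k φ ψ} {evaluates : True (valid? k λ π → not (φ π) ∨ ψ π)} → Implies k φ ψ
implies-by-evaluation {evaluates = evaluates} = implies (valid-by-evaluation {evaluates = evaluates})

implies⇒ : ∀ {k} {ps : Vec ℕ k} {φ ψ} → Sorted ps → Implies k φ ψ → ∀ E → T (at ps φ E) → T (at ps ψ E)
implies⇒ {ps = ps} {φ} {ψ} sorted (implies pointwise) E φE
  with at ps φ E | at ps ψ E | valid⇒true sorted pointwise E
... | true | true | _ = _

record Balanced (k : ℕ) (Φ Ψ : List (Profile k → Bool)) : Set where
  constructor balanced
  field pointwise : Valid k λ π → indicators Φ π ≡ᵇ indicators Ψ π

balanced-by-evaluation : ∀ {k Φ Ψ} {evaluates : True (valid? k λ π → indicators Φ π ≡ᵇ indicators Ψ π)} →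
  Balanced k Φ Ψ
balanced-by-evaluation {evaluates = evaluates} = balanced (valid-by-evaluation {evaluates = evaluates})

balanced⇒counts : ∀ {k} {ps : Vec ℕ k} {Φ Ψ} → Sorted ps → Balanced k Φ Ψ →
  ∀ L → counts L (map (at ps) Φ) ≡ counts L (map (at ps) Ψ)
balanced⇒counts {ps = ps} {Φ} {Ψ} sorted (balanced pointwise) =
  count-linear (map (at ps) Φ) (map (at ps) Ψ) λ E → begin
    indicators (map (at ps) Φ) E          ≡⟨ cong sum (map-∘ Φ) ⟨
    indicators Φ (profile (lookup ps) E)  ≡⟨ ≡ᵇ⇒≡ _ _ (valid⇒true sorted pointwise E) ⟩
    indicators Ψ (profile (lookup ps) E)  ≡⟨ cong sum (map-∘ Ψ) ⟩
    indicators (map (at ps) Ψ) E          ∎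
  where open ≡-Reasoning

count-split₂ : ∀ {k} {ps : Vec ℕ k} {φ ψ₁ ψ₂} → Sorted ps → Balanced k (φ ∷ []) (ψ₁ ∷ ψ₂ ∷ []) →
  ∀ L → count L (at ps φ) ≡ count L (at ps ψ₁) + count L (at ps ψ₂)
count-split₂ {ps = ps} {φ} {ψ₁} {ψ₂} sorted split L = begin
  count L (at ps φ)                              ≡⟨ +-identityʳ _ ⟨
  count L (at ps φ) + 0                          ≡⟨ balanced⇒counts sorted split L ⟩
  count L (at ps ψ₁) + (count L (at ps ψ₂) + 0)  ≡⟨ cong (count L (at ps ψ₁) +_) (+-identityʳ _) ⟩
  count L (at ps ψ₁) + count L (at ps ψ₂)        ∎
  where open ≡-Reasoning

count-split₃ : ∀ {k} {ps : Vec ℕ k} {φ ψ₁ ψ₂ ψ₃} → Sorted ps → Balanced k (φ ∷ []) (ψ₁ ∷ ψ₂ ∷ ψ₃ ∷ []) →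
  ∀ L → count L (at ps φ) ≡ count L (at ps ψ₁) + (count L (at ps ψ₂) + count L (at ps ψ₃))
count-split₃ {ps = ps} {φ} {ψ₁} {ψ₂} {ψ₃} sorted split L = begin
  count L (at ps φ)                                                     ≡⟨ +-identityʳ _ ⟨
  count L (at ps φ) + 0                                                 ≡⟨ balanced⇒counts sorted split L ⟩
  count L (at ps ψ₁) + (count L (at ps ψ₂) + (count L (at ps ψ₃) + 0))
    ≡⟨ cong (λ c → count L (at ps ψ₁) + (count L (at ps ψ₂) + c)) (+-identityʳ _) ⟩
  count L (at ps ψ₁) + (count L (at ps ψ₂) + count L (at ps ψ₃))        ∎
  where open ≡-Reasoning

record AlwaysCross (k : ℕ) (φ ψ : Profile k → Bool) : Set where
  constructor always-cross
  field holds : ∀ {p} → p < zone-count k → ∀ {q} → q < zone-count k →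
                ∀ {r} → r < zone-count k → ∀ {s} → s < zone-count k →
                T (φ (profile odd (p , q))) → T (ψ (profile odd (r , s))) → Crosses (p , q) (r , s)

always-cross? : ∀ k φ ψ → Dec (AlwaysCross k φ ψ)
always-cross? k φ ψ = map′ always-cross AlwaysCross.holds $
  allUpTo? (λ p → allUpTo? (λ q → allUpTo? (λ r → allUpTo? (λ s →
    T? (φ (profile odd (p , q))) →-dec (T? (ψ (profile odd (r , s))) →-dec T? (crossᵇ (p , q) (r , s))))
    (zone-count k)) (zone-count k)) (zone-count k)) (zone-count k)

always-cross-by-evaluation : ∀ {k φ ψ} {evaluates : True (always-cross? k φ ψ)} → AlwaysCross k φ ψ
always-cross-by-evaluation {k} {φ} {ψ} {evaluates} = toWitness {a? = always-cross? k φ ψ} evaluates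

always-cross⇒Crosses : ∀ {k} {ps : Vec ℕ k} {φ ψ} → Sorted ps → AlwaysCross k φ ψ → ∀ E F →
  T (at ps φ E) → T (at ps ψ F) → Crosses E F
always-cross⇒Crosses {ps = ps} {φ} {ψ} sorted (always-cross holds) E@(p , q) F@(r , s) φE ψF =
  Crosses-zone ps E F (holds (zone-bound ps p) (zone-bound ps q) (zone-bound ps r) (zone-bound ps s)
    (subst (T ∘ φ) (profile-zone sorted E) φE) (subst (T ∘ ψ) (profile-zone sorted F) ψF))

always-cross⇒exclusive : ∀ {k} {ps : Vec ℕ k} {φ ψ} → Sorted ps → AlwaysCross k φ ψ →
  ∀ {L} → Compatible L → count L (at ps φ) ≡ 0 ⊎ count L (at ps ψ) ≡ 0
always-cross⇒exclusive sorted clash = count-exclusive (always-cross⇒Crosses sorted clash _ _)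

common-summand : ∀ {q r r' x y} → q + r ≡ x → q + r' ≡ y → r ≡ 0 ⊎ r' ≡ 0 → q ≡ x ⊓ y
common-summand {q} {r' = r'} refl refl (inj₁ refl) =
  sym (trans (cong (_⊓ (q + r')) (+-identityʳ q)) (m≤n⇒m⊓n≡m (m≤m+n q r')))
common-summand {q} {r} refl refl (inj₂ refl) =
  sym (trans (cong ((q + r) ⊓_) (+-identityʳ q)) (m≥n⇒m⊓n≡n (m≤m+n q r)))

count-as-min : ∀ {k} {ps : Vec ℕ k} {φ₁ φ₂ κ ρ₁ ρ₂} → Sorted ps →
  Balanced k (φ₁ ∷ []) (κ ∷ ρ₁ ∷ []) → Balanced k (φ₂ ∷ []) (κ ∷ ρ₂ ∷ []) → AlwaysCross k ρ₁ ρ₂ →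
  ∀ {L} → Compatible L → count L (at ps κ) ≡ count L (at ps φ₁) ⊓ count L (at ps φ₂)
count-as-min sorted split₁ split₂ clash {L} compatible = common-summand
  (sym (count-split₂ sorted split₁ L)) (sym (count-split₂ sorted split₂ L))
  (always-cross⇒exclusive sorted clash compatible)

-- For a triangle u < v < w: s₁, s₂, s₃ count crossings with uv, uw, vw; cu counts the
-- chords cutting off the corner u (crossing uv and uw), and tu the chords through u
-- crossing vw.  The alternatives hold in a compatible collection because a chord
-- through u crosses every chord cutting off u, and chords through two different
-- vertices cross.
record TriangleCounts (s₁ s₂ s₃ : ℕ) : Set where
  field
    cu cv cw tu tv tw : ℕ
    side₁ : s₁ ≡ cu + (cv + tw)
    side₂ : s₂ ≡ cu + (cw + tv)
    side₃ : s₃ ≡ cv + (cw + tu)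
    tu-cu : tu ≡ 0 ⊎ cu ≡ 0
    tv-cv : tv ≡ 0 ⊎ cv ≡ 0
    tw-cw : tw ≡ 0 ⊎ cw ≡ 0
    tu-tv : tu ≡ 0 ⊎ tv ≡ 0
    tu-tw : tu ≡ 0 ⊎ tw ≡ 0
    tv-tw : tv ≡ 0 ⊎ tw ≡ 0

module _ where
  open import Data.Nat.Tactic.RingSolver using (solve-∀)
  open TriangleCounts

  rotate : ∀ {s₁ s₂ s₃} → TriangleCounts s₁ s₂ s₃ → TriangleCounts s₃ s₁ s₂
  rotate t = record
    { cu = cv t ; cv = cw t ; cw = cu t ; tu = tv t ; tv = tw t ; tw = tu t
    ; side₁ = side₃ t
    ; side₂ = trans (side₁ t) (x∙yz≈y∙xz (cu t) (cv t) (tw t))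
    ; side₃ = trans (side₂ t) (x∙yz≈y∙xz (cu t) (cw t) (tv t))
    ; tu-cu = tv-cv t ; tv-cv = tw-cw t ; tw-cw = tu-cu t
    ; tu-tv = tv-tw t ; tu-tw = swap (tu-tv t) ; tv-tw = swap (tu-tw t)
    }

  through-formula : ∀ {cu cv cw tu tv tw} → tu ≡ 0 ⊎ cu ≡ 0 → tu ≡ 0 ⊎ tv ≡ 0 → tu ≡ 0 ⊎ tw ≡ 0 →
    tu ≡ cv + (cw + tu) ∸ (cu + (cv + tw) + (cu + (cw + tv)))
  through-formula {cu} {cv} {cw} {zero} {tv} {tw} _ _ _ = sym (m≤n⇒m∸n≡0 (begin
    cv + (cw + 0)                      ≡⟨ cong (cv +_) (+-identityʳ cw) ⟩
    cv + cw                            ≤⟨ +-mono-≤ (≤-trans (m≤m+n cv tw) (m≤n+m _ cu))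
                                                    (≤-trans (m≤m+n cw tv) (m≤n+m _ cu)) ⟩
    cu + (cv + tw) + (cu + (cw + tv))  ∎))
    where open ≤-Reasoning
  through-formula {cv = cv} {cw} {suc t} (inj₂ refl) (inj₂ refl) (inj₂ refl) = begin
    suc t                                               ≡⟨ m+n∸m≡n (cv + cw) (suc t) ⟨
    cv + cw + suc t ∸ (cv + cw)                         ≡⟨ cong₂ _∸_ (+-assoc cv cw (suc t)) (arrange cv cw) ⟩
    cv + (cw + suc t) ∸ (0 + (cv + 0) + (0 + (cw + 0))) ∎
    where
    open ≡-Reasoning
    arrange : ∀ x y → x + y ≡ 0 + (x + 0) + (0 + (y + 0))
    arrange = solve-∀

  through-u-unique : ∀ {s₁ s₂ s₃} (t t' : TriangleCounts s₁ s₂ s₃) → tu t ≡ tu t'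
  through-u-unique t t' = trans (formula t) (sym (formula t'))
    where
    formula : ∀ {s₁ s₂ s₃} (t : TriangleCounts s₁ s₂ s₃) → tu t ≡ s₃ ∸ (s₁ + s₂)
    formula t rewrite side₁ t | side₂ t | side₃ t = through-formula (tu-cu t) (tu-tv t) (tu-tw t)

  corner-identity : ∀ {s₁ s₂ s₃} (t : TriangleCounts s₁ s₂ s₃) →
    2 * cu t + (s₃ + (tv t + tw t)) ≡ s₁ + s₂ + tu t
  corner-identity t rewrite side₁ t | side₂ t | side₃ t = identity (cu t) (cv t) (cw t) (tu t) (tv t) (tw t)
    where
    identity : ∀ cu cv cw tu tv tw →
      2 * cu + (cv + (cw + tu) + (tv + tw)) ≡ cu + (cv + tw) + (cu + (cw + tv)) + tu
    identity = solve-∀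

  corner-u-unique : ∀ {s₁ s₂ s₃} (t t' : TriangleCounts s₁ s₂ s₃) → cu t ≡ cu t'
  corner-u-unique {s₁} {s₂} {s₃} t t' = *-cancelˡ-≡ (cu t) (cu t') 2 (+-cancelʳ-≡ _ _ _ (begin
    2 * cu t + (s₃ + (tv t + tw t))     ≡⟨ corner-identity t ⟩
    s₁ + s₂ + tu t                      ≡⟨ cong (s₁ + s₂ +_) (through-u-unique t t') ⟩
    s₁ + s₂ + tu t'                     ≡⟨ corner-identity t' ⟨
    2 * cu t' + (s₃ + (tv t' + tw t'))  ≡⟨ cong (λ c → 2 * cu t' + (s₃ + c)) (cong₂ _+_ tv≡ tw≡) ⟨
    2 * cu t' + (s₃ + (tv t + tw t))    ∎))
    where
    open ≡-Reasoning
    tv≡ : tv t ≡ tv t'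
    tv≡ = through-u-unique (rotate t) (rotate t')
    tw≡ : tw t ≡ tw t'
    tw≡ = through-u-unique (rotate (rotate t)) (rotate (rotate t'))

  corners-unique : ∀ {s₁ s₂ s₃ s₁' s₂' s₃'} → s₁ ≡ s₁' → s₂ ≡ s₂' → s₃ ≡ s₃' →
    (t : TriangleCounts s₁ s₂ s₃) (t' : TriangleCounts s₁' s₂' s₃') →
    cu t ≡ cu t' × cv t ≡ cv t' × cw t ≡ cw t'
  corners-unique refl refl refl t t' =
    corner-u-unique t t' ,
    corner-u-unique (rotate t) (rotate t') ,
    corner-u-unique (rotate (rotate t)) (rotate (rotate t'))

module Triangle where

  uv uw vw : Profile 3 → Bool
  uv = crosses 0F 1F
  uw = crosses 0F 2F
  vw = crosses 1F 2F

  cornerU cornerV cornerW throughU throughV throughW : Profile 3 → Bool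
  cornerU = uv ∧̇ uw
  cornerV = uv ∧̇ vw
  cornerW = uw ∧̇ vw
  throughU = vw ∧̇ ¬̇ (uv ∨̇ uw)
  throughV = uw ∧̇ ¬̇ (uv ∨̇ vw)
  throughW = uv ∧̇ ¬̇ (uw ∨̇ vw)

  split-uv : Balanced 3 (uv ∷ []) (cornerU ∷ cornerV ∷ throughW ∷ [])
  split-uv = balanced-by-evaluation
  split-uw : Balanced 3 (uw ∷ []) (cornerU ∷ cornerW ∷ throughV ∷ [])
  split-uw = balanced-by-evaluation
  split-vw : Balanced 3 (vw ∷ []) (cornerV ∷ cornerW ∷ throughU ∷ [])
  split-vw = balanced-by-evaluation

  throughU-cornerU : AlwaysCross 3 throughU cornerU
  throughU-cornerU = always-cross-by-evaluation
  throughV-cornerV : AlwaysCross 3 throughV cornerV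
  throughV-cornerV = always-cross-by-evaluation
  throughW-cornerW : AlwaysCross 3 throughW cornerW
  throughW-cornerW = always-cross-by-evaluation
  throughU-throughV : AlwaysCross 3 throughU throughV
  throughU-throughV = always-cross-by-evaluation
  throughU-throughW : AlwaysCross 3 throughU throughW
  throughU-throughW = always-cross-by-evaluation
  throughV-throughW : AlwaysCross 3 throughV throughW
  throughV-throughW = always-cross-by-evaluation

  module _ {u v w} (u<v : u < v) (v<w : v < w) where

    private
      ps : Vec ℕ 3
      ps = u ∷ v ∷ w ∷ []

      sorted : Sorted ps
      sorted = (u<v ∷ <-trans u<v v<w ∷ []) ∷ (v<w ∷ []) ∷ [] ∷ []

    triangle-counts : ∀ {L} → Compatible L →
      TriangleCounts (crossings L (u , v)) (crossings L (u , w)) (crossings L (v , w))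
    triangle-counts {L} compatible = record
      { cu = count L (at ps cornerU) ; cv = count L (at ps cornerV) ; cw = count L (at ps cornerW)
      ; tu = count L (at ps throughU) ; tv = count L (at ps throughV) ; tw = count L (at ps throughW)
      ; side₁ = count-split₃ sorted split-uv L
      ; side₂ = count-split₃ sorted split-uw L
      ; side₃ = count-split₃ sorted split-vw L
      ; tu-cu = always-cross⇒exclusive sorted throughU-cornerU compatible
      ; tv-cv = always-cross⇒exclusive sorted throughV-cornerV compatible
      ; tw-cw = always-cross⇒exclusive sorted throughW-cornerW compatible
      ; tu-tv = always-cross⇒exclusive sorted throughU-throughV compatible
      ; tu-tw = always-cross⇒exclusive sorted throughU-throughW compatible
      ; tv-tw = always-cross⇒exclusive sorted throughV-throughW compatible
      }

    corners-agree : ∀ {L₁ L₂} → Compatible L₁ → Compatible L₂ →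
      crossings L₁ (u , v) ≡ crossings L₂ (u , v) → crossings L₁ (u , w) ≡ crossings L₂ (u , w) →
      crossings L₁ (v , w) ≡ crossings L₂ (v , w) →
      count L₁ (at ps cornerU) ≡ count L₂ (at ps cornerU) ×
      count L₁ (at ps cornerV) ≡ count L₂ (at ps cornerV) ×
      count L₁ (at ps cornerW) ≡ count L₂ (at ps cornerW)
    corners-agree compatible₁ compatible₂ uv≡ uw≡ vw≡ =
      corners-unique uv≡ uw≡ vw≡ (triangle-counts compatible₁) (triangle-counts compatible₂)

module Quadrilateral where

  ab bc cd ad ac bd is-ac is-bd : Profile 4 → Bool
  ab = crosses 0F 1F
  bc = crosses 1F 2F
  cd = crosses 2F 3F
  ad = crosses 0F 3F
  ac = crosses 0F 2F
  bd = crosses 1F 3F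
  is-ac = is 0F 2F
  is-bd = is 1F 3F

  cornerA cornerB cornerC cornerD : Profile 4 → Bool
  cornerA = ab ∧̇ ad
  cornerB = ab ∧̇ bc
  cornerC = bc ∧̇ cd
  cornerD = ad ∧̇ cd

  corners sides : List (Profile 4 → Bool)
  corners = cornerA ∷ cornerB ∷ cornerC ∷ cornerD ∷ []
  sides = ab ∷ bc ∷ cd ∷ ad ∷ []

  diagonals-and-corners : Balanced 4 (ac ∷ bd ∷ corners) (is-ac ∷ is-bd ∷ sides)
  diagonals-and-corners = balanced-by-evaluation

  -- The chords cutting off a corner of abcd are those cutting off that corner in both
  -- triangles of a triangulation of abcd; a chord doing so only in the first triangle
  -- crosses every chord doing so only in the second, so count-as-min applies.
  split-ab∧ac : Balanced 4 (ab ∧̇ ac ∷ []) (cornerA ∷ ab ∧̇ ac ∧̇ ¬̇ ad ∷ [])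
  split-ab∧ac = balanced-by-evaluation
  split-ac∧ad : Balanced 4 (ac ∧̇ ad ∷ []) (cornerA ∷ ac ∧̇ ad ∧̇ ¬̇ ab ∷ [])
  split-ac∧ad = balanced-by-evaluation
  clash-A : AlwaysCross 4 (ab ∧̇ ac ∧̇ ¬̇ ad) (ac ∧̇ ad ∧̇ ¬̇ ab)
  clash-A = always-cross-by-evaluation

  split-ac∧bc : Balanced 4 (ac ∧̇ bc ∷ []) (cornerC ∷ ac ∧̇ bc ∧̇ ¬̇ cd ∷ [])
  split-ac∧bc = balanced-by-evaluation
  split-ac∧cd : Balanced 4 (ac ∧̇ cd ∷ []) (cornerC ∷ ac ∧̇ cd ∧̇ ¬̇ bc ∷ [])
  split-ac∧cd = balanced-by-evaluation
  clash-C : AlwaysCross 4 (ac ∧̇ bc ∧̇ ¬̇ cd) (ac ∧̇ cd ∧̇ ¬̇ bc)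
  clash-C = always-cross-by-evaluation

  split-ab∧bd : Balanced 4 (ab ∧̇ bd ∷ []) (cornerB ∷ ab ∧̇ bd ∧̇ ¬̇ bc ∷ [])
  split-ab∧bd = balanced-by-evaluation
  split-bc∧bd : Balanced 4 (bc ∧̇ bd ∷ []) (cornerB ∷ bc ∧̇ bd ∧̇ ¬̇ ab ∷ [])
  split-bc∧bd = balanced-by-evaluation
  clash-B : AlwaysCross 4 (ab ∧̇ bd ∧̇ ¬̇ bc) (bc ∧̇ bd ∧̇ ¬̇ ab)
  clash-B = always-cross-by-evaluation

  split-ad∧bd : Balanced 4 (ad ∧̇ bd ∷ []) (cornerD ∷ ad ∧̇ bd ∧̇ ¬̇ cd ∷ [])
  split-ad∧bd = balanced-by-evaluation
  split-bd∧cd : Balanced 4 (bd ∧̇ cd ∷ []) (cornerD ∷ bd ∧̇ cd ∧̇ ¬̇ ad ∷ [])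
  split-bd∧cd = balanced-by-evaluation
  clash-D : AlwaysCross 4 (ad ∧̇ bd ∧̇ ¬̇ cd) (bd ∧̇ cd ∧̇ ¬̇ ad)
  clash-D = always-cross-by-evaluation

  detour-ab-ac : Implies 4 (¬̇ ac ∧̇ ab) bd
  detour-ab-ac = implies-by-evaluation
  detour-bc-ac : Implies 4 (¬̇ ac ∧̇ bc) bd
  detour-bc-ac = implies-by-evaluation
  detour-cd-ac : Implies 4 (¬̇ ac ∧̇ cd) bd
  detour-cd-ac = implies-by-evaluation
  detour-ad-ac : Implies 4 (¬̇ ac ∧̇ ad) bd
  detour-ad-ac = implies-by-evaluation

  detour-ab-bd : Implies 4 (¬̇ bd ∧̇ ab) ac
  detour-ab-bd = implies-by-evaluation
  detour-bc-bd : Implies 4 (¬̇ bd ∧̇ bc) ac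
  detour-bc-bd = implies-by-evaluation
  detour-cd-bd : Implies 4 (¬̇ bd ∧̇ cd) ac
  detour-cd-bd = implies-by-evaluation
  detour-ad-bd : Implies 4 (¬̇ bd ∧̇ ad) ac
  detour-ad-bd = implies-by-evaluation

  module _ {a b c d} (a<b : a < b) (b<c : b < c) (c<d : c < d) where

    private
      ps : Vec ℕ 4
      ps = a ∷ b ∷ c ∷ d ∷ []

      a<c = <-trans a<b b<c
      b<d = <-trans b<c c<d

      sorted : Sorted ps
      sorted = (a<b ∷ a<c ∷ <-trans a<c c<d ∷ []) ∷ (b<c ∷ b<d ∷ []) ∷ (c<d ∷ []) ∷ [] ∷ []

      C : Collection → (Profile 4 → Bool) → ℕ
      C L φ = count L (at ps φ)

      Σ : Collection → List (Profile 4 → Bool) → ℕ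
      Σ L φs = counts L (map (at ps) φs)

      identity : ∀ L → C L ac + (C L bd + Σ L corners) ≡ C L is-ac + (C L is-bd + Σ L sides)
      identity = balanced⇒counts sorted diagonals-and-corners

    ac-from-bd : ∀ L → intersection L (a , c) ≡ (C L is-bd + Σ L sides) ⊖ (C L bd + Σ L corners)
    ac-from-bd L = trans (intersection≡⊖ L (a , c))
      (⊖-transpose (C L ac) (C L bd + Σ L corners) (C L is-ac) (C L is-bd + Σ L sides) (identity L))

    bd-from-ac : ∀ L → intersection L (b , d) ≡ (C L is-ac + Σ L sides) ⊖ (C L ac + Σ L corners)
    bd-from-ac L = trans (intersection≡⊖ L (b , d))
      (⊖-transpose (C L bd) (C L ac + Σ L corners) (C L is-bd) (C L is-ac + Σ L sides) (begin
        C L bd + (C L ac + Σ L corners)      ≡⟨ x∙yz≈y∙xz (C L bd) (C L ac) (Σ L corners) ⟩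
        C L ac + (C L bd + Σ L corners)      ≡⟨ identity L ⟩
        C L is-ac + (C L is-bd + Σ L sides)  ≡⟨ x∙yz≈y∙xz (C L is-ac) (C L is-bd) (Σ L sides) ⟩
        C L is-bd + (C L is-ac + Σ L sides)  ∎))
      where open ≡-Reasoning

    around-ac : ∀ E → ¬ Crosses E (a , c) →
      (Crosses E (a , b) → Crosses E (b , d)) × (Crosses E (b , c) → Crosses E (b , d)) ×
      (Crosses E (c , d) → Crosses E (b , d)) × (Crosses E (a , d) → Crosses E (b , d))
    around-ac E avoids = via detour-ab-ac , via detour-bc-ac , via detour-cd-ac , via detour-ad-ac
      where
      via : ∀ {σ ξ} → Implies 4 (¬̇ ac ∧̇ σ) ξ → T (at ps σ E) → T (at ps ξ E)
      via detour σE = implies⇒ sorted detour E (T-not∧ avoids σE)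

    around-bd : ∀ E → ¬ Crosses E (b , d) →
      (Crosses E (a , b) → Crosses E (a , c)) × (Crosses E (b , c) → Crosses E (a , c)) ×
      (Crosses E (c , d) → Crosses E (a , c)) × (Crosses E (a , d) → Crosses E (a , c))
    around-bd E avoids = via detour-ab-bd , via detour-bc-bd , via detour-cd-bd , via detour-ad-bd
      where
      via : ∀ {σ ξ} → Implies 4 (¬̇ bd ∧̇ σ) ξ → T (at ps σ E) → T (at ps ξ E)
      via detour σE = implies⇒ sorted detour E (T-not∧ avoids σE)

    module _ {L₁ L₂} (compatible₁ : Compatible L₁) (compatible₂ : Compatible L₂) where
      open Agreement compatible₁ compatible₂

      private
        via-min : ∀ {φ₁ φ₂ κ ρ₁ ρ₂} → Balanced 4 (φ₁ ∷ []) (κ ∷ ρ₁ ∷ []) → Balanced 4 (φ₂ ∷ []) (κ ∷ ρ₂ ∷ []) →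
          AlwaysCross 4 ρ₁ ρ₂ → C L₁ φ₁ ≡ C L₂ φ₁ → C L₁ φ₂ ≡ C L₂ φ₂ → C L₁ κ ≡ C L₂ κ
        via-min {φ₁} {φ₂} {κ} split₁ split₂ clash φ₁≡ φ₂≡ = begin
          C L₁ κ             ≡⟨ count-as-min sorted split₁ split₂ clash compatible₁ ⟩
          C L₁ φ₁ ⊓ C L₁ φ₂  ≡⟨ cong₂ _⊓_ φ₁≡ φ₂≡ ⟩
          C L₂ φ₁ ⊓ C L₂ φ₂  ≡⟨ count-as-min sorted split₁ split₂ clash compatible₂ ⟨
          C L₂ κ             ∎
          where open ≡-Reasoning

        corners-agree : C L₁ cornerA ≡ C L₂ cornerA → C L₁ cornerB ≡ C L₂ cornerB →
          C L₁ cornerC ≡ C L₂ cornerC → C L₁ cornerD ≡ C L₂ cornerD → Σ L₁ corners ≡ Σ L₂ corners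
        corners-agree A B C D = cong₂ _+_ A (cong₂ _+_ B (cong₂ _+_ C (cong (_+ 0) D)))

      quadrilateral : Agree (a , b) → Agree (b , c) → Agree (c , d) → Agree (a , d) →
        (Agree (a , c) → Agree (b , d)) × (Agree (b , d) → Agree (a , c))
      quadrilateral ab≡ bc≡ cd≡ ad≡ = ac⇒bd , bd⇒ac
        where
        open ≡-Reasoning

        sides≡ : Σ L₁ sides ≡ Σ L₂ sides
        sides≡ = cong₂ _+_ (crossings-agree ab≡) (cong₂ _+_ (crossings-agree bc≡)
                   (cong₂ _+_ (crossings-agree cd≡) (cong (_+ 0) (crossings-agree ad≡))))

        ac⇒bd : Agree (a , c) → Agree (b , d)
        ac⇒bd ac≡ = begin
          intersection L₁ (b , d)                                ≡⟨ bd-from-ac L₁ ⟩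
          (C L₁ is-ac + Σ L₁ sides) ⊖ (C L₁ ac + Σ L₁ corners)  ≡⟨ cong₂ _⊖_ (cong₂ _+_ (mult-agree ac≡) sides≡)
                                                                             (cong₂ _+_ (crossings-agree ac≡) corners≡) ⟩
          (C L₂ is-ac + Σ L₂ sides) ⊖ (C L₂ ac + Σ L₂ corners)  ≡⟨ bd-from-ac L₂ ⟨
          intersection L₂ (b , d)                                ∎
          where
          abc = Triangle.corners-agree a<b b<c compatible₁ compatible₂
                  (crossings-agree ab≡) (crossings-agree ac≡) (crossings-agree bc≡)
          acd = Triangle.corners-agree a<c c<d compatible₁ compatible₂
                  (crossings-agree ac≡) (crossings-agree ad≡) (crossings-agree cd≡)
          corners≡ = corners-agree
            (via-min split-ab∧ac split-ac∧ad clash-A (proj₁ abc) (proj₁ acd))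
            (proj₁ (proj₂ abc))
            (via-min split-ac∧bc split-ac∧cd clash-C (proj₂ (proj₂ abc)) (proj₁ (proj₂ acd)))
            (proj₂ (proj₂ acd))

        bd⇒ac : Agree (b , d) → Agree (a , c)
        bd⇒ac bd≡ = begin
          intersection L₁ (a , c)                                ≡⟨ ac-from-bd L₁ ⟩
          (C L₁ is-bd + Σ L₁ sides) ⊖ (C L₁ bd + Σ L₁ corners)  ≡⟨ cong₂ _⊖_ (cong₂ _+_ (mult-agree bd≡) sides≡)
                                                                             (cong₂ _+_ (crossings-agree bd≡) corners≡) ⟩
          (C L₂ is-bd + Σ L₂ sides) ⊖ (C L₂ bd + Σ L₂ corners)  ≡⟨ ac-from-bd L₂ ⟨
          intersection L₂ (a , c)                                ∎
          where
          abd = Triangle.corners-agree a<b b<d compatible₁ compatible₂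
                  (crossings-agree ab≡) (crossings-agree ad≡) (crossings-agree bd≡)
          bcd = Triangle.corners-agree b<c c<d compatible₁ compatible₂
                  (crossings-agree bc≡) (crossings-agree bd≡) (crossings-agree cd≡)
          corners≡ = corners-agree
            (proj₁ abd)
            (via-min split-ab∧bd split-bc∧bd clash-B (proj₁ (proj₂ abd)) (proj₁ bcd))
            (proj₁ (proj₂ bcd))
            (via-min split-ad∧bd split-bd∧cd clash-D (proj₂ (proj₂ abd)) (proj₂ (proj₂ bcd)))

-- Triangulations are maximal

nested-or-crossing : ∀ p q r s → (p ≤ r × s ≤ q) ⊎ (r ≤ p × q ≤ s) ⊎ (p < r × q < s) ⊎ (r < p × s < q)
nested-or-crossing p q r s with <-cmp p r | <-cmp q s
... | tri< p<r _ _ | tri< q<s _ _ = inj₂ (inj₂ (inj₁ (p<r , q<s)))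
... | tri< p<r _ _ | tri≈ _ refl _ = inj₁ (<⇒≤ p<r , ≤-refl)
... | tri< p<r _ _ | tri> _ _ s<q = inj₁ (<⇒≤ p<r , <⇒≤ s<q)
... | tri≈ _ refl _ | tri< q<s _ _ = inj₂ (inj₁ (≤-refl , <⇒≤ q<s))
... | tri≈ _ refl _ | tri≈ _ refl _ = inj₁ (≤-refl , ≤-refl)
... | tri≈ _ refl _ | tri> _ _ s<q = inj₁ (≤-refl , <⇒≤ s<q)
... | tri> _ _ r<p | tri< q<s _ _ = inj₂ (inj₁ (<⇒≤ r<p , <⇒≤ q<s))
... | tri> _ _ r<p | tri≈ _ refl _ = inj₂ (inj₁ (<⇒≤ r<p , ≤-refl))
... | tri> _ _ r<p | tri> _ _ s<q = inj₂ (inj₂ (inj₂ (r<p , s<q)))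

-- apex (p , q) is the third vertex of the triangle below (p , q) once the family is
-- completed to a triangulation: the largest s < q with (p , s) in the family, or p + 1.
module Apex {m} (F : Fin m → Diag) (noncrossing : ∀ i j → ¬ Crosses (F i) (F j)) where
  open import Data.List using (filter)
  open import Data.List.Extrema.Nat using (max; ⊥≤max; xs≤max; max<v⁺; argmax-sel)
  open import Data.List.Membership.Propositional using (_∈_)
  open import Data.List.Membership.Propositional.Properties using (∈-map∘filter⁺; ∈-map∘filter⁻; ∈-allFin)

  below? : ∀ p q i → Dec (proj₁ (F i) ≡ p × proj₂ (F i) < q)
  below? p q i = (proj₁ (F i) ≟ p) ×-dec (proj₂ (F i) <? q)

  below : ℕ → ℕ → List ℕ
  below p q = map (proj₂ ∘ F) (filter (below? p q) (allFin m))

  below⁺ : ∀ {p q s} i → F i ≡ (p , s) → s < q → s ∈ below p q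
  below⁺ {p} {q} i refl s<q = ∈-map∘filter⁺ (proj₂ ∘ F) (below? p q) (i , ∈-allFin i , refl , refl , s<q)

  below⁻ : ∀ {p q s} → s ∈ below p q → ∃[ i ] F i ≡ (p , s) × s < q
  below⁻ {p} {q} s∈ with ∈-map∘filter⁻ (proj₂ ∘ F) (below? p q) {xs = allFin m} s∈
  ... | i , _ , refl , refl , s<q = i , refl , s<q

  apex : Diag → ℕ
  apex (p , q) = max (suc p) (below p q)

  apex-lower : ∀ p q → p < apex (p , q)
  apex-lower p q = ⊥≤max (suc p) (below p q)

  apex-upper : ∀ p q → suc p < q → apex (p , q) < q
  apex-upper p q p+1<q = max<v⁺ p+1<q (All.tabulate λ s∈ → proj₂ (proj₂ (below⁻ s∈)))

  apex-covers : ∀ {p q s} i → F i ≡ (p , s) → s < q → s ≤ apex (p , q)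
  apex-covers {p} {q} i Fi≡ s<q = All.lookup (xs≤max (suc p) (below p q)) (below⁺ i Fi≡ s<q)

  apex-attained : ∀ p q → apex (p , q) ≡ suc p ⊎ ∃[ i ] F i ≡ (p , apex (p , q))
  apex-attained p q with argmax-sel id (suc p) (below p q)
  ... | inj₁ apex≡ = inj₁ apex≡
  ... | inj₂ apex∈ = let i , Fi≡ , _ = below⁻ apex∈ in inj₂ (i , Fi≡)

  apex-unnested : ∀ {p q r s} j → F j ≡ (r , s) → p ≤ r → s ≤ q → (r , s) ≢ (p , q) →
    r < apex (p , q) → apex (p , q) < s → ⊥
  apex-unnested {p} {q} {r} {s} j Fj≡ p≤r s≤q distinct r<x x<s with <-cmp p r
  ... | tri≈ _ refl _ = <⇒≱ x<s (apex-covers j Fj≡ (≤∧≢⇒< s≤q (distinct ∘ cong (p ,_))))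
  ... | tri> _ _ r<p = <⇒≱ r<p p≤r
  ... | tri< p<r _ _ with apex-attained p q
  ...   | inj₁ x≡ = <⇒≱ (subst (r <_) x≡ r<x) p<r
  ...   | inj₂ (i , Fi≡) = noncrossing i j (subst₂ Crosses (sym Fi≡) (sym Fj≡) (Crosses-intro p<r r<x x<s))

  apex-injective : ∀ {i j p q r s} → F i ≡ (p , q) → F j ≡ (r , s) → suc p < q → suc r < s →
    apex (p , q) ≡ apex (r , s) → (p , q) ≡ (r , s)
  apex-injective {i} {j} {p} {q} {r} {s} Fi≡ Fj≡ wide₁ wide₂ same = decide (≡-dec _≟_ _≟_ (p , q) (r , s))
    where
    p<x = apex-lower p q
    x<q = apex-upper p q wide₁
    r<x = subst (r <_) (sym same) (apex-lower r s)
    x<s = subst (_< s) (sym same) (apex-upper r s wide₂)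

    impossible : (p , q) ≢ (r , s) → (p ≤ r × s ≤ q) ⊎ (r ≤ p × q ≤ s) ⊎ (p < r × q < s) ⊎ (r < p × s < q) → ⊥
    impossible distinct (inj₁ (p≤r , s≤q)) = apex-unnested j Fj≡ p≤r s≤q (distinct ∘ sym) r<x x<s
    impossible distinct (inj₂ (inj₁ (r≤p , q≤s))) =
      apex-unnested i Fi≡ r≤p q≤s distinct (subst (p <_) same p<x) (subst (_< q) same x<q)
    impossible _ (inj₂ (inj₂ (inj₁ (p<r , q<s)))) =
      noncrossing i j (subst₂ Crosses (sym Fi≡) (sym Fj≡) (Crosses-intro p<r (<-trans r<x x<q) q<s))
    impossible _ (inj₂ (inj₂ (inj₂ (r<p , s<q)))) =
      noncrossing j i (subst₂ Crosses (sym Fj≡) (sym Fi≡) (Crosses-intro r<p (<-trans p<x x<s) s<q))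

    decide : Dec ((p , q) ≡ (r , s)) → (p , q) ≡ (r , s)
    decide (yes equal) = equal
    decide (no distinct) = ⊥-elim (impossible distinct (nested-or-crossing p q r s))

-- Distinct non-crossing chords have distinct apexes, all lying in 1, …, M.
noncrossing-family-size : ∀ {m M} (F : Fin m → Diag) → (∀ i j → F i ≡ F j → i ≡ j) →
  (∀ i j → ¬ Crosses (F i) (F j)) → (∀ i → suc (proj₁ (F i)) < proj₂ (F i)) → (∀ i → proj₂ (F i) ≤ suc M) →
  m ≤ M
noncrossing-family-size {m} {M} F injective noncrossing wide bounded = ≮⇒≥ too-many
  where
  open Apex F noncrossing

  apex-bounds : ∀ i → 0 < apex (F i) × apex (F i) ≤ M
  apex-bounds i = <-≤-trans (s≤s z≤n) (apex-lower _ _) , ≤-pred (<-≤-trans (apex-upper _ _ (wide i)) (bounded i))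

  pred< : ∀ {x} → 0 < x × x ≤ M → pred x < M
  pred< {suc x} (_ , x<M) = x<M

  slot : Fin m → Fin M
  slot i = Fin.fromℕ< (pred< (apex-bounds i))

  slot-injective : ∀ i j → slot i ≡ slot j → F i ≡ F j
  slot-injective i j slot≡ = apex-injective refl refl (wide i) (wide j)
    (pred-injective ⦃ >-nonZero (proj₁ (apex-bounds i)) ⦄ ⦃ >-nonZero (proj₁ (apex-bounds j)) ⦄ (begin
      pred (apex (F i))  ≡⟨ Fin.toℕ-fromℕ< (pred< (apex-bounds i)) ⟨
      Fin.toℕ (slot i)   ≡⟨ cong Fin.toℕ slot≡ ⟩
      Fin.toℕ (slot j)   ≡⟨ Fin.toℕ-fromℕ< (pred< (apex-bounds j)) ⟩
      pred (apex (F j))  ∎))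
    where open ≡-Reasoning

  too-many : ¬ M < m
  too-many M<m with Fin.pigeonhole M<m slot
  ... | i , j , i<j , slot≡ = Fin.<-irrefl (injective i j (slot-injective i j slot≡)) i<j

triangulation-maximal : ∀ {n} {Tr : Triangulation n} → IsTriangulation n Tr → ∀ {X} → IsDiagonal (3 + n) X →
  (∀ i → ¬ Crosses (Tr i) X) → ∃[ i ] Tr i ≡ X
triangulation-maximal {n} {Tr} (diagonal , injective , noncrossing) {X} X-diagonal uncrossed =
  decide (Fin.any? λ i → ≡-dec _≟_ _≟_ (Tr i) X)
  where
  G : Fin (2 + n) → Diag
  G zero = 0 , 2 + n
  G (suc zero) = X
  G (suc (suc i)) = Tr i

  G-wide : ∀ i → suc (proj₁ (G i)) < proj₂ (G i)
  G-wide zero = s≤s (s≤s z≤n)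
  G-wide (suc zero) = proj₁ X-diagonal
  G-wide (suc (suc i)) = proj₁ (diagonal i)

  G-bounded : ∀ i → proj₂ (G i) ≤ 2 + n
  G-bounded zero = ≤-refl
  G-bounded (suc zero) = ≤-pred (proj₁ (proj₂ X-diagonal))
  G-bounded (suc (suc i)) = ≤-pred (proj₁ (proj₂ (diagonal i)))

  G-noncrossing : ∀ i j → ¬ Crosses (G i) (G j)
  G-noncrossing zero j = outer-edge-uncrossed (proj₁ (G j)) (proj₂ (G j)) (G-bounded j)
  G-noncrossing i zero = outer-edge-uncrossed (proj₁ (G i)) (proj₂ (G i)) (G-bounded i) ∘ Crosses-sym {G i} {G zero}
  G-noncrossing (suc zero) (suc zero) = Crosses-irrefl X
  G-noncrossing (suc zero) (suc (suc j)) c = uncrossed j (Crosses-sym {X} {Tr j} c)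
  G-noncrossing (suc (suc i)) (suc zero) = uncrossed i
  G-noncrossing (suc (suc i)) (suc (suc j)) = noncrossing i j

  not-outer : ∀ {D} → IsDiagonal (3 + n) D → (0 , 2 + n) ≢ D
  not-outer (_ , _ , not-outer-edge) refl = not-outer-edge (refl , refl)

  G-injective : (∀ i → Tr i ≢ X) → ∀ i j → G i ≡ G j → i ≡ j
  G-injective _ zero zero _ = refl
  G-injective _ zero (suc zero) eq = ⊥-elim (not-outer X-diagonal eq)
  G-injective _ zero (suc (suc j)) eq = ⊥-elim (not-outer (diagonal j) eq)
  G-injective _ (suc zero) zero eq = ⊥-elim (not-outer X-diagonal (sym eq))
  G-injective _ (suc (suc i)) zero eq = ⊥-elim (not-outer (diagonal i) (sym eq))
  G-injective _ (suc zero) (suc zero) _ = refl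
  G-injective absent (suc zero) (suc (suc j)) eq = ⊥-elim (absent j (sym eq))
  G-injective absent (suc (suc i)) (suc zero) eq = ⊥-elim (absent i eq)
  G-injective _ (suc (suc i)) (suc (suc j)) eq = cong (Fin.suc ∘ Fin.suc) (injective i j eq)

  decide : Dec (∃[ i ] Tr i ≡ X) → ∃[ i ] Tr i ≡ X
  decide (yes found) = found
  decide (no absent) = ⊥-elim (<-irrefl refl
    (noncrossing-family-size G (G-injective λ i eq → absent (i , eq)) G-noncrossing G-wide G-bounded))

-- Propagation along the triangulation

-- Induction on the number μ X of diagonals of T crossing X: a diagonal Tᵢ crossing X
-- spans with X a quadrilateral, and every Tⱼ crossing one of its sides crosses X.
module Propagation {n} {Tr : Triangulation n} (triangulation : IsTriangulation n Tr)
  {L₁ L₂ : Collection} (compatible₁ : Compatible L₁) (compatible₂ : Compatible L₂)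
  (diagonals₁ : All (IsDiagonal (3 + n) ∘ proj₁) L₁) (diagonals₂ : All (IsDiagonal (3 + n) ∘ proj₁) L₂)
  (agree-on-T : ∀ i → intersection L₁ (Tr i) ≡ intersection L₂ (Tr i)) where

  open Agreement compatible₁ compatible₂
  import Data.List as List

  private
    noncrossing : ∀ i j → ¬ Crosses (Tr i) (Tr j)
    noncrossing = proj₂ (proj₂ triangulation)

  μ : Diag → ℕ
  μ = crossings (List.tabulate λ i → Tr i , 1)

  shorter : ∀ {X Y} i → (∀ j → Crosses (Tr j) Y → Crosses (Tr j) X) → ¬ Crosses (Tr i) Y → Crosses (Tr i) X →
    μ Y < μ X
  shorter i implied avoids crosses =
    count-< _ (AllP.tabulate⁺ implied) (AnyP.tabulate⁺ i (s≤s z≤n , avoids , crosses))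

  mult-non-diagonal : ∀ {L Y} → All (IsDiagonal (3 + n) ∘ proj₁) L → ¬ IsDiagonal (3 + n) Y → mult L Y ≡ 0
  mult-non-diagonal {L} {Y} diagonals ¬diagonal = count-none L (All.map
    (λ {(E , _)} diagonal E≡Y → ¬diagonal (subst (IsDiagonal (3 + n)) (eqᵇ⇒≡ E Y E≡Y) diagonal)) diagonals)

  non-diagonal-agrees : ∀ {Y} → ¬ IsDiagonal (3 + n) Y → (∀ E → IsDiagonal (3 + n) E → ¬ Crosses E Y) → Agree Y
  non-diagonal-agrees {Y} ¬diagonal uncrossed = trans (vanishes diagonals₁) (sym (vanishes diagonals₂))
    where
    vanishes : ∀ {L} → All (IsDiagonal (3 + n) ∘ proj₁) L → intersection L Y ≡ 0 ⊖ 0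
    vanishes {L} diagonals = trans (intersection≡⊖ L Y) (cong₂ _⊖_
      (count-none L (All.map (λ {(E , _)} → uncrossed E) diagonals)) (mult-non-diagonal diagonals ¬diagonal))

  agree-uncrossed : ∀ {q s} → q < s → s < 3 + n → (∀ i → ¬ Crosses (Tr i) (q , s)) → Agree (q , s)
  agree-uncrossed {q} {s} q<s s<N uncrossed with diagonal-or-edge q<s s<N
  ... | inj₁ diagonal = let i , Tr≡ = triangulation-maximal triangulation diagonal uncrossed in
                        subst Agree Tr≡ (agree-on-T i)
  ... | inj₂ (inj₁ refl) = non-diagonal-agrees (λ (wide , _) → <-irrefl refl wide) (λ E _ → edge-uncrossed E q)
  ... | inj₂ (inj₂ (refl , s+1≡N)) =
    non-diagonal-agrees (λ (_ , _ , not-outer-edge) → not-outer-edge (refl , s+1≡N)) λ (e₁ , e₂) (_ , e₂<N , _) →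
      outer-edge-uncrossed e₁ e₂ (≤-pred (subst (e₂ <_) (sym s+1≡N) e₂<N)) ∘ Crosses-sym {e₁ , e₂} {0 , s}

  agree : ∀ k {q s} → q < s → s < 3 + n → μ (q , s) ≤ k → Agree (q , s)
  agree-below : ∀ k {X x y} → x < y → y < 3 + n → μ (x , y) < μ X → μ X ≤ k → Agree (x , y)
  agree-crossed : ∀ k {q s} → q < s → s < 3 + n → μ (q , s) ≤ k → ∀ i → Crosses (Tr i) (q , s) → Agree (q , s)

  agree k {q} {s} q<s s<N μ≤k with Fin.any? (λ i → T? (crossᵇ (Tr i) (q , s)))
  ... | no uncrossed = agree-uncrossed q<s s<N λ i c → uncrossed (i , c)
  ... | yes (i , crossing) = agree-crossed k q<s s<N μ≤k i crossing

  agree-below zero _ _ μ< μ≤0 = ⊥-elim (<⇒≱ (<-≤-trans μ< μ≤0) z≤n)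
  agree-below (suc k) x<y y<N μ< μ≤k = agree k x<y y<N (≤-pred (<-≤-trans μ< μ≤k))

  agree-crossed k {q} {s} q<s s<N μ≤k i crossing =
    [ ac-known , bd-known ]′ (Crosses-view {proj₁ (Tr i)} {proj₂ (Tr i)} crossing)
    where
    open Quadrilateral
    p = proj₁ (Tr i)
    r = proj₂ (Tr i)

    side : ∀ {x y} → x < y → y < 3 + n → (∀ j → Crosses (Tr j) (x , y) → Crosses (Tr j) (q , s)) →
      ¬ Crosses (Tr i) (x , y) → Agree (x , y)
    side x<y y<N implied avoids = agree-below k x<y y<N (shorter i implied avoids crossing) μ≤k

    ac-known : p < q × q < r × r < s → Agree (q , s)
    ac-known (p<q , q<r , r<s) =
      proj₁ (quadrilateral p<q q<r r<s compatible₁ compatible₂ pq qr rs ps) (agree-on-T i)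
      where
      r<N = <-trans r<s s<N
      q<N = <-trans q<r r<N
      around = λ j → around-ac p<q q<r r<s (Tr j) (noncrossing j i)
      pq = side p<q q<N (proj₁ ∘ around) (shared-end-uncrossed p r p q (inj₁ refl))
      qr = side q<r r<N (proj₁ ∘ proj₂ ∘ around) (shared-end-uncrossed p r q r (inj₂ (inj₂ (inj₂ refl))))
      rs = side r<s s<N (proj₁ ∘ proj₂ ∘ proj₂ ∘ around) (shared-end-uncrossed p r r s (inj₂ (inj₂ (inj₁ refl))))
      ps = side (<-trans p<q (<-trans q<r r<s)) s<N (proj₂ ∘ proj₂ ∘ proj₂ ∘ around)
             (shared-end-uncrossed p r p s (inj₁ refl))

    bd-known : q < p × p < s × s < r → Agree (q , s)
    bd-known (q<p , p<s , s<r) =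
      proj₂ (quadrilateral q<p p<s s<r compatible₁ compatible₂ qp ps sr qr) (agree-on-T i)
      where
      r<N = proj₁ (proj₂ (proj₁ triangulation i))
      around = λ j → around-bd q<p p<s s<r (Tr j) (noncrossing j i)
      qp = side q<p (<-trans p<s s<N) (proj₁ ∘ around) (shared-end-uncrossed p r q p (inj₂ (inj₁ refl)))
      ps = side p<s s<N (proj₁ ∘ proj₂ ∘ around) (shared-end-uncrossed p r p s (inj₁ refl))
      sr = side s<r r<N (proj₁ ∘ proj₂ ∘ proj₂ ∘ around) (shared-end-uncrossed p r s r (inj₂ (inj₂ (inj₂ refl))))
      qr = side (<-trans q<p (<-trans p<s s<r)) r<N (proj₂ ∘ proj₂ ∘ proj₂ ∘ around)
             (shared-end-uncrossed p r q r (inj₂ (inj₂ (inj₂ refl))))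

  mult-agrees : ∀ X → mult L₁ X ≡ mult L₂ X
  mult-agrees X@(p , q) with isDiagonal? (3 + n) X
  ... | yes (wide , q<N , _) = mult-agree (agree (μ X) (≤-trans (n≤1+n (suc p)) wide) q<N ≤-refl)
  ... | no ¬diagonal =
    trans (mult-non-diagonal diagonals₁ ¬diagonal) (sym (mult-non-diagonal diagonals₂ ¬diagonal))

-- Collections are determined by their multiplicities

module _ where
  open import Data.List.Membership.Propositional using (_∈_; find)
  open import Data.List.Membership.Propositional.Properties.WithK using (unique∧set⇒bag)
  open import Data.List.Relation.Binary.BagAndSetEquality using (∼bag⇒↭)
  open import Function.Bundles using (mk⇔)

  Distinct : Collection → Set
  Distinct = AllPairs λ D E → proj₁ D ≢ proj₁ E

  ∈⇒mult : ∀ {L D k} → Distinct L → (D , k) ∈ L → mult L D ≡ k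
  ∈⇒mult {(D , k) ∷ L} (others ∷ _) (here refl) = begin
    ⟦ eqᵇ D D ⟧ * k + mult L D  ≡⟨ cong₂ (λ b m → ⟦ b ⟧ * k + m) (Equivalence.to T-≡ (eqᵇ-refl D)) absent ⟩
    1 * k + 0                   ≡⟨ trans (+-identityʳ (1 * k)) (*-identityˡ k) ⟩
    k                           ∎
    where
    open ≡-Reasoning
    absent : mult L D ≡ 0
    absent = count-none L (All.map (λ D≢E E≡D → D≢E (sym (eqᵇ⇒≡ _ D E≡D))) others)
  ∈⇒mult {(E , _) ∷ L} {D} (others ∷ distinct) (there D∈L) with eqᵇ E D in E≡D
  ... | true = ⊥-elim (All.lookup others D∈L (eqᵇ⇒≡ E D (subst T (sym E≡D) _)))
  ... | false = ∈⇒mult distinct D∈L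

  mult>0⇒∈ : ∀ {L D} → 0 < mult L D → ∃[ k ] (D , k) ∈ L
  mult>0⇒∈ {L} {D} mult>0 with find (count>0⇒any L mult>0)
  ... | (E , k) , E∈L , E≡D = k , subst (λ F → (F , k) ∈ L) (eqᵇ⇒≡ E D E≡D) E∈L

  mult-determines : ∀ {L₁ L₂} → Distinct L₁ → Distinct L₂ → Positive L₁ → Positive L₂ →
    (∀ D → mult L₁ D ≡ mult L₂ D) → L₁ ↭ L₂
  mult-determines distinct₁ distinct₂ positive₁ positive₂ same =
    ∼bag⇒↭ (unique∧set⇒bag (unique distinct₁) (unique distinct₂)
      (mk⇔ (transfer distinct₁ distinct₂ positive₁ same)
           (transfer distinct₂ distinct₁ positive₂ (sym ∘ same))))
    where
    unique : ∀ {L} → Distinct L → AllPairs _≢_ L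
    unique = AllPairs.map λ D≢E → D≢E ∘ cong proj₁

    transfer : ∀ {L L'} → Distinct L → Distinct L' → Positive L → (∀ D → mult L D ≡ mult L' D) →
      ∀ {Dk} → Dk ∈ L → Dk ∈ L'
    transfer {L} {L'} distinct distinct' positive same {D , k} Dk∈L
      with mult>0⇒∈ {L'} (subst (0 <_) (trans (sym (∈⇒mult distinct Dk∈L)) (same D))
                                       (All.lookup positive Dk∈L))
    ... | k' , Dk'∈L' = subst (λ j → (D , j) ∈ L') k'≡k Dk'∈L'
      where
      k'≡k : k' ≡ k
      k'≡k = trans (sym (∈⇒mult distinct' Dk'∈L')) (trans (sym (same D)) (∈⇒mult distinct Dk∈L))

monomial-compatible : ∀ {N L} → IsClusterMonomial N L → Compatible L
monomial-compatible = AllPairs.map proj₂ ∘ proj₂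

dvec-determines-monomial : ∀ {n} {Tr : Triangulation n} → IsTriangulation n Tr →
  ∀ {L₁ L₂} → IsClusterMonomial (3 + n) L₁ → IsClusterMonomial (3 + n) L₂ → dvec Tr L₁ ≗ dvec Tr L₂ → L₁ ↭ L₂
dvec-determines-monomial triangulation monomial₁@(entries₁ , pairs₁) monomial₂@(entries₂ , pairs₂) same =
  mult-determines (AllPairs.map proj₁ pairs₁) (AllPairs.map proj₁ pairs₂)
    (All.map proj₂ entries₁) (All.map proj₂ entries₂)
    (Propagation.mult-agrees triangulation (monomial-compatible monomial₁) (monomial-compatible monomial₂)
      (All.map proj₁ entries₁) (All.map proj₁ entries₂) same)

module NegativePart {n} {Tr : Triangulation n} (triangulation : IsTriangulation n Tr) (a : Fin n → ℤ) where
  open import Data.Integer using (+_; -[1+_])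
  open import Data.List.Membership.Propositional using (_∈_)
  open import Data.List.Membership.Propositional.Properties using (∈-allFin)
  open import Data.List.Relation.Unary.Unique.Propositional.Properties using (allFin⁺)

  private
    injective : ∀ i j → Tr i ≡ Tr j → i ≡ j
    injective = proj₁ (proj₂ triangulation)

    noncrossing : ∀ i j → ¬ Crosses (Tr i) (Tr j)
    noncrossing = proj₂ (proj₂ triangulation)

  count-negEntry : ∀ {φ} D z → count (negEntry D z) φ ≡ ⟦ φ D ⟧ * neg z
  count-negEntry {φ} D (+ _) = sym (*-zeroʳ ⟦ φ D ⟧)
  count-negEntry {φ} D -[1+ k ] = +-identityʳ (⟦ φ D ⟧ * suc k)

  entries : List (Fin n) → Collection
  entries = foldr (λ i acc → negEntry (Tr i) (a i) ++ acc) []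

  entries-All : ∀ {P : Diag × ℕ → Set} is → All (λ i → ∀ k → a i ≡ -[1+ k ] → P (Tr i , suc k)) is →
    All P (entries is)
  entries-All [] [] = []
  entries-All (i ∷ is) (Pᵢ ∷ Pᵢₛ) with a i
  ... | + _ = entries-All is Pᵢₛ
  ... | -[1+ k ] = Pᵢ k refl ∷ entries-All is Pᵢₛ

  entries-compatible : ∀ is → AllPairs _≢_ is →
    AllPairs (λ D E → proj₁ D ≢ proj₁ E × ¬ Crosses (proj₁ D) (proj₁ E)) (entries is)
  entries-compatible [] [] = []
  entries-compatible (i ∷ is) (i∉ ∷ unique) with a i
  ... | + _ = entries-compatible is unique
  ... | -[1+ k ] = entries-All is (All.map (λ {j} i≢j _ _ → i≢j ∘ injective i j , noncrossing i j) i∉)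
                   ∷ entries-compatible is unique

  mult-entries : ∀ is → AllPairs _≢_ is → ∀ {i} → i ∈ is → mult (entries is) (Tr i) ≡ neg (a i)
  mult-entries (i ∷ is) (i∉ ∷ _) (here refl) = begin
    mult (negEntry (Tr i) (a i) ++ entries is) (Tr i)                ≡⟨ count-++ (negEntry (Tr i) (a i)) (entries is) ⟩
    mult (negEntry (Tr i) (a i)) (Tr i) + mult (entries is) (Tr i)  ≡⟨ cong₂ _+_ (count-negEntry (Tr i) (a i)) absent ⟩
    ⟦ eqᵇ (Tr i) (Tr i) ⟧ * neg (a i) + 0
      ≡⟨ cong (λ b → ⟦ b ⟧ * neg (a i) + 0) (Equivalence.to T-≡ (eqᵇ-refl (Tr i))) ⟩
    1 * neg (a i) + 0                                                ≡⟨ trans (+-identityʳ _) (*-identityˡ _) ⟩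
    neg (a i)                                                        ∎
    where
    open ≡-Reasoning
    absent : mult (entries is) (Tr i) ≡ 0
    absent = count-none (entries is)
      (entries-All is (All.map (λ i≢j _ _ Tj≡Ti → i≢j (sym (injective _ i (eqᵇ⇒≡ _ _ Tj≡Ti)))) i∉))
  mult-entries (j ∷ is) (j∉ ∷ unique) {i} (there i∈) = begin
    mult (negEntry (Tr j) (a j) ++ entries is) (Tr i)                ≡⟨ count-++ (negEntry (Tr j) (a j)) (entries is) ⟩
    mult (negEntry (Tr j) (a j)) (Tr i) + mult (entries is) (Tr i)  ≡⟨ cong₂ _+_ (count-negEntry (Tr j) (a j))
                                                                                 (mult-entries is unique i∈) ⟩
    ⟦ eqᵇ (Tr j) (Tr i) ⟧ * neg (a j) + neg (a i)                    ≡⟨ cong (λ b → ⟦ b ⟧ * neg (a j) + neg (a i)) Tj≢Ti ⟩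
    neg (a i)                                                        ∎
    where
    open ≡-Reasoning
    Tj≢Ti : eqᵇ (Tr j) (Tr i) ≡ false
    Tj≢Ti = ¬T⇒≡false λ Tj≡Ti → All.lookup j∉ i∈ (injective j i (eqᵇ⇒≡ _ _ Tj≡Ti))

  negPart-entries : All (λ D → IsDiagonal (3 + n) (proj₁ D) × 0 < proj₂ D) (negPart Tr a)
  negPart-entries = entries-All (allFin n) (AllP.tabulate⁺ λ i _ _ → proj₁ triangulation i , s≤s z≤n)

  negPart-compatible : AllPairs (λ D E → proj₁ D ≢ proj₁ E × ¬ Crosses (proj₁ D) (proj₁ E)) (negPart Tr a)
  negPart-compatible = entries-compatible (allFin n) (allFin⁺ n)

  negPart-avoided : ∀ {L} → Compatible L → Positive L → (∀ i → intersection L (Tr i) ≡ posPart a i) →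
    All (λ D → All (λ E → proj₁ D ≢ proj₁ E × ¬ Crosses (proj₁ D) (proj₁ E)) (negPart Tr a)) L
  negPart-avoided {L} compatible positive d[L] = All.tabulate λ D∈L →
    entries-All (allFin n) (AllP.tabulate⁺ λ i k aᵢ≡ → All.lookup (avoids i k aᵢ≡) D∈L)
    where
    avoids : ∀ i k → a i ≡ -[1+ k ] → All (λ D → proj₁ D ≢ Tr i × ¬ Crosses (proj₁ D) (Tr i)) L
    avoids i k aᵢ≡ = vanishing-intersection compatible positive (trans (d[L] i) (cong (λ z → + pos z) aᵢ≡))

  intersection-negPart : ∀ i → intersection (negPart Tr a) (Tr i) ≡ 0 ⊖ neg (a i)
  intersection-negPart i = trans (intersection≡⊖ (negPart Tr a) (Tr i))
    (cong₂ _⊖_ uncrossed (mult-entries (allFin n) (allFin⁺ n) (∈-allFin i)))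
    where
    uncrossed : crossings (negPart Tr a) (Tr i) ≡ 0
    uncrossed = count-none (negPart Tr a) (entries-All (allFin n) (AllP.tabulate⁺ λ j _ _ → noncrossing j i))

  pos+neg : ∀ z → + pos z ℤ.+ (0 ⊖ neg z) ≡ z
  pos+neg (+ k) = ℤ.+-identityʳ (+ k)
  pos+neg -[1+ k ] = refl

  append-monomial : ∀ {M} → IsClusterMonomial (3 + n) M → dvec Tr M ≗ posPart a →
    IsClusterMonomial (3 + n) (M ++ negPart Tr a)
  append-monomial M-monomial@(M-entries , M-pairs) d[M] =
    AllP.++⁺ M-entries negPart-entries ,
    AllPairsP.++⁺ M-pairs negPart-compatible
      (negPart-avoided (monomial-compatible M-monomial) (All.map proj₂ M-entries) d[M])

  append-dvec : ∀ M → dvec Tr M ≗ posPart a → dvec Tr (M ++ negPart Tr a) ≗ a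
  append-dvec M d[M] i = begin
    intersection (M ++ negPart Tr a) (Tr i)                       ≡⟨ intersection-++ M (negPart Tr a) (Tr i) ⟩
    intersection M (Tr i) ℤ.+ intersection (negPart Tr a) (Tr i)  ≡⟨ cong₂ ℤ._+_ (d[M] i) (intersection-negPart i) ⟩
    + pos (a i) ℤ.+ (0 ⊖ neg (a i))                               ≡⟨ pos+neg (a i) ⟩
    a i                                                           ∎
    where open ≡-Reasoning

-- The hypothesis [a]₊ ∈ 𝒲 only guarantees that M exists; here M is given.
lemma3p5 : (n : ℕ) (Tr : Triangulation n) → IsTriangulation n Tr →
    (a : Fin n → ℤ) → InW n Tr (posPart a) →
    (M : Collection) → IsClusterMonomial (3 + n) M → dvec Tr M ≗ posPart a →
    IsClusterMonomial (3 + n) (M ++ negPart Tr a) ×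
    dvec Tr (M ++ negPart Tr a) ≗ a ×
    ((M' : Collection) → IsClusterMonomial (3 + n) M' → dvec Tr M' ≗ a →
      M' ↭ (M ++ negPart Tr a))
lemma3p5 n Tr triangulation a _ M M-monomial d[M] =
  append-monomial M-monomial d[M] ,
  append-dvec M d[M] ,
  λ M' M'-monomial d[M'] → dvec-determines-monomial triangulation M'-monomial (append-monomial M-monomial d[M])
                             λ i → trans (d[M'] i) (sym (append-dvec M d[M] i))
  where open NegativePart triangulation a
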